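{- Let $\mathscr{G}$ be a non-deterministic functor, and $\mathcal{G}$ a binary relation on the set of $\mathscr{G}$-expressions. If $(\mathcal{B}_{\mathscr{G}}, \mathcal{F}_0 = \{\}, \mathcal{G}_0 = \lceil\mathcal{G}\rceil) \Rightarrow^{*} (\mathcal{B}_{\mathscr{G}}, \mathcal{F}_n, \mathcal{G}_n = \{\})$ using the rules [Reduce], [Derive] and [Simplify], then $\mathcal{G} \subseteq \sim_{\mathscr{G}}$.
   Context: Non-deterministic functors $\mathscr{G}:\mathbf{Set}\to\mathbf{Set}$ are built from $Id$, finite join-semilattice constants $\mathsf{B}$, product, the sum $X\uplus Y\uplus\{\bot,\top\}$, exponentiation by a finite alphabet $A$ and finite powerset. $\mathsf{Exp}_{\mathscr{G}}$ is the set of closed, guarded, well-typed generalized regular expressions for $\mathscr{G}$, with coalgebra structure $\delta_{\mathscr{G}\triangleleft\mathscr{G}}:\mathsf{Exp}_{\mathscr{G}}\to\mathscr{G}(\mathsf{Exp}_{\mathscr{G}})$, and $\sim_{\mathscr{G}}$ is bisimilarity. $\mathcal{E}_{\mathscr{G}}$ is the algebraic specification encoding the functor, the expressions, their typing, structured expressions and the equations defining $\delta$. $\mathcal{B}_{\mathscr{G}}$ is the CIRC theory with algebraic part $\mathcal{E}_{\mathscr{G}}$, single derivative $\delta_{\mathscr{G}\triangleleft\mathscr{G}}(*{:}\mathsf{Exp})$ (only equations of sort $\mathsf{Exp}$ are derivable), and equational interpolants: $\langle\sigma_1,\sigma_2\rangle=\langle\sigma_1',\sigma_2'\rangle \Rightarrow\{\sigma_1=\sigma_1',\sigma_2=\sigma_2'\}$;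 $k_i(\sigma)=k_i(\sigma')\Rightarrow\{\sigma=\sigma'\}$; $f=g\Rightarrow\{f(a)=g(a)\mid a\in A\}$; for sets, $\{\sigma_1..\sigma_n\}=\{\sigma_1'..\sigma_m'\}$ reduces to every $\sigma_i$ equal to some $\sigma'_j$ and every $\sigma'_j$ equal to some $\sigma_i$; and $t=t'\Rightarrow\{t\simeq t'=\mathit{true}\}$ making semilattice-sorted equations non-derivable. $\lceil\cdot\rceil$ is the freezing operator (moving terms to a fresh sort $\mathsf{Frozen}$, blocking congruence); $\lceil\mathcal{G}\rceil$ is the set of frozen equations $\lceil\varepsilon\rceil=\lceil\varepsilon'\rceil$ for pairs in $\mathcal{G}$. Entailment $\vdash$ is the extended equational entailment $\vdash_{NDF}$ (ordinary entailment plus rules decomposing frozen equalities of pairs, injections, functions and sets componentwise, plus the interpolants). CIRC reduction rules on triples (specification, hypotheses $\mathcal{F}$, goals): [Reduce] removes a goal $\lceil e\rceil$ if $\mathcal{B}\cup\mathcal{F}\vdash\lceil e\rceil$; [Derive] for a derivable goal $\lceil e\rceil$ not entailed by $\mathcal{B}\cup\mathcal{F}$ adds $\lceil e\rceil$ to the hypotheses and its frozen derivatives $\lceil\delta[e]\rceil$ to the goals; [Simplify] replaces a goal $\lceil\theta(e)\rceil$ by $\{\lceil\theta(e_i)\rceil\mid i\in I\}$ when $e\Rightarrow\{e_i\mid i\in I\}$ is an interpolant and $\theta$ a substitution. -}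

module Defs where

open import Data.Nat using (ℕ; zero; suc; _<_; _<ᵇ_; _≡ᵇ_; pred)
open import Data.Fin using (Fin; _≟_)
open import Data.Bool using (Bool; if_then_else_)
open import Data.List using (List; []; _∷_; _++_; map; length; lookup; allFin)
open import Data.List.Relation.Unary.All using (All)
open import Data.List.Relation.Unary.Any using (Any)
open import Data.List.Relation.Binary.Permutation.Propositional using (_↭_)
open import Data.Product using (Σ; _×_; _,_; ∃; proj₁; proj₂)
open import Data.Unit using () renaming (⊤ to ⊤')
open import Data.Empty using () renaming (⊥ to ⊥')
open import Relation.Nullary using (¬_; yes; no)
open import Relation.Binary.PropositionalEquality using (_≡_; _≢_)

record FJSL : Set where
  field
    size   : ℕ
    join   : Fin size → Fin size → Fin size
    bot    : Fin size
    assoc  : ∀ x y z → join (join x y) z ≡ join x (join y z)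
    comm   : ∀ x y → join x y ≡ join y x
    idem   : ∀ x → join x x ≡ x
    unit   : ∀ x → join bot x ≡ x

open FJSL using (size; join; bot)

data Fun : Set where
  Id   : Fun
  K    : FJSL → Fun
  _⊠_  : Fun → Fun → Fun
  _⊞_  : Fun → Fun → Fun
  _^^_ : Fun → ℕ → Fun
  𝒫    : Fun → Fun

data Sum3 (X Y : Set) : Set where
  κ₁  : X → Sum3 X Y
  κ₂  : Y → Sum3 X Y
  ⊥ₛ  : Sum3 X Y
  ⊤ₛ  : Sum3 X Y

-- action on sets; finite subsets are represented by lists
-- (bisimilarity below only looks at them through membership)
⟦_⟧ : Fun → Set → Set
⟦ Id ⟧ X     = X
⟦ K L ⟧ X    = Fin (size L)
⟦ F ⊠ H ⟧ X  = ⟦ F ⟧ X × ⟦ H ⟧ X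
⟦ F ⊞ H ⟧ X  = Sum3 (⟦ F ⟧ X) (⟦ H ⟧ X)
⟦ F ^^ k ⟧ X = Fin k → ⟦ F ⟧ X
⟦ 𝒫 F ⟧ X    = List (⟦ F ⟧ X)

data Expr : Set where
  ∅     : Expr
  _⊕_   : Expr → Expr → Expr
  var   : ℕ → Expr
  μ     : Expr → Expr                 -- μx.ε, x bound = var 0
  bc    : (L : FJSL) → Fin (size L) → Expr
  l⟨_⟩  : Expr → Expr
  r⟨_⟩  : Expr → Expr
  l[_]  : Expr → Expr
  r[_]  : Expr → Expr
  act   : (k : ℕ) → Fin k → Expr → Expr
  sng   : Expr → Expr

data Cl (n : ℕ) : Expr → Set where
  ∅  : Cl n ∅
  pl : ∀ {e e'} → Cl n e → Cl n e' → Cl n (e ⊕ e')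
  vr : ∀ {m} → m < n → Cl n (var m)
  μ  : ∀ {e} → Cl (suc n) e → Cl n (μ e)
  bc : ∀ {L b} → Cl n (bc L b)
  lp : ∀ {e} → Cl n e → Cl n l⟨ e ⟩
  rp : ∀ {e} → Cl n e → Cl n r⟨ e ⟩
  ls : ∀ {e} → Cl n e → Cl n l[ e ]
  rs : ∀ {e} → Cl n e → Cl n r[ e ]
  ac : ∀ {k a e} → Cl n e → Cl n (act k a e)
  sg : ∀ {e} → Cl n e → Cl n (sng e)

data Gd : Expr → Set where
  ∅  : Gd ∅
  pl : ∀ {e e'} → Gd e → Gd e' → Gd (e ⊕ e')
  μ  : ∀ {e} → Gd e → Gd (μ e)
  bc : ∀ {L b} → Gd (bc L b)
  lp : ∀ {e} → Gd l⟨ e ⟩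
  rp : ∀ {e} → Gd r⟨ e ⟩
  ls : ∀ {e} → Gd l[ e ]
  rs : ∀ {e} → Gd r[ e ]
  ac : ∀ {k a e} → Gd (act k a e)
  sg : ∀ {e} → Gd (sng e)

data WG : Expr → Set where
  ∅  : WG ∅
  pl : ∀ {e e'} → WG e → WG e' → WG (e ⊕ e')
  vr : ∀ {m} → WG (var m)
  μ  : ∀ {e} → Gd e → WG e → WG (μ e)
  bc : ∀ {L b} → WG (bc L b)
  lp : ∀ {e} → WG e → WG l⟨ e ⟩
  rp : ∀ {e} → WG e → WG r⟨ e ⟩
  ls : ∀ {e} → WG e → WG l[ e ]
  rs : ∀ {e} → WG e → WG r[ e ]
  ac : ∀ {k a e} → WG e → WG (act k a e)
  sg : ∀ {e} → WG e → WG (sng e)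

-- typing  ⊢ ε : F ◁ G  is  Ty G ε F
data Ty (G : Fun) : Expr → Fun → Set where
  ∅   : ∀ {F} → Ty G ∅ F
  pl  : ∀ {F e e'} → Ty G e F → Ty G e' F → Ty G (e ⊕ e') F
  vr  : ∀ {m} → Ty G (var m) G
  μ   : ∀ {e} → Ty G e G → Ty G (μ e) G
  id  : ∀ {e} → Ty G e G → Ty G e Id
  bc  : ∀ {L b} → Ty G (bc L b) (K L)
  lp  : ∀ {F H e} → Ty G e F → Ty G l⟨ e ⟩ (F ⊠ H)
  rp  : ∀ {F H e} → Ty G e H → Ty G r⟨ e ⟩ (F ⊠ H)
  ls  : ∀ {F H e} → Ty G e F → Ty G l[ e ] (F ⊞ H)
  rs  : ∀ {F H e} → Ty G e H → Ty G r[ e ] (F ⊞ H)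
  ac  : ∀ {F k a e} → Ty G e F → Ty G (act k a e) (F ^^ k)
  sg  : ∀ {F e} → Ty G e F → Ty G (sng e) (𝒫 F)

ExpT : Fun → Fun → Expr → Set
ExpT G F e = Cl 0 e × WG e × Ty G e F

Exp : Fun → Expr → Set
Exp G = ExpT G G

-- substitution of a (closed) expression s for variable n
sub : ℕ → Expr → Expr → Expr
sub n s ∅           = ∅
sub n s (e ⊕ e')    = sub n s e ⊕ sub n s e'
sub n s (var m)     = if m ≡ᵇ n then s else (if m <ᵇ n then var m else var (pred m))
sub n s (μ e)       = μ (sub (suc n) s e)
sub n s (bc L b)    = bc L b
sub n s l⟨ e ⟩      = l⟨ sub n s e ⟩
sub n s r⟨ e ⟩      = r⟨ sub n s e ⟩
sub n s l[ e ]      = l[ sub n s e ]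
sub n s r[ e ]      = r[ sub n s e ]
sub n s (act k a e) = act k a (sub n s e)
sub n s (sng e)     = sng (sub n s e)

unfold : Expr → Expr
unfold e = sub 0 (μ e) e

Empty : (F : Fun) → ⟦ F ⟧ Expr
Empty Id       = ∅
Empty (K L)    = bot L
Empty (F ⊠ H)  = Empty F , Empty H
Empty (F ⊞ H)  = ⊥ₛ
Empty (F ^^ k) = λ _ → Empty F
Empty (𝒫 F)    = []

Plus : (F : Fun) → ⟦ F ⟧ Expr → ⟦ F ⟧ Expr → ⟦ F ⟧ Expr
Plus Id e e'                   = e ⊕ e'
Plus (K L) b b'                = join L b b'
Plus (F ⊠ H) (x , y) (x' , y') = Plus F x x' , Plus H y y'
Plus (F ⊞ H) (κ₁ x) (κ₁ x')    = κ₁ (Plus F x x')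
Plus (F ⊞ H) (κ₂ y) (κ₂ y')    = κ₂ (Plus H y y')
Plus (F ⊞ H) ⊥ₛ v              = v
Plus (F ⊞ H) (κ₁ x) ⊥ₛ         = κ₁ x
Plus (F ⊞ H) (κ₂ y) ⊥ₛ         = κ₂ y
Plus (F ⊞ H) ⊤ₛ v              = ⊤ₛ
Plus (F ⊞ H) (κ₁ x) (κ₂ y)     = ⊤ₛ
Plus (F ⊞ H) (κ₂ y) (κ₁ x)     = ⊤ₛ
Plus (F ⊞ H) (κ₁ x) ⊤ₛ         = ⊤ₛ
Plus (F ⊞ H) (κ₂ y) ⊤ₛ         = ⊤ₛ
Plus (F ^^ k) f g              = λ a → Plus F (f a) (g a)
Plus (𝒫 F) xs ys               = xs ++ ys

ifEq : ∀ {k} {A : Set} → Fin k → Fin k → A → A → A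
ifEq a a' x y with a ≟ a'
... | yes _ = x
... | no _  = y

-- δ is given as (the graph of) the function defined by the usual
-- equations; Δ G F ε v  means  δ_{F◁G}(ε) = v.
data Δ (G : Fun) : (F : Fun) → Expr → ⟦ F ⟧ Expr → Set where
  d∅  : ∀ {F} → Δ G F ∅ (Empty F)
  d⊕  : ∀ {F e e' v v'} → Δ G F e v → Δ G F e' v' → Δ G F (e ⊕ e') (Plus F v v')
  dμ  : ∀ {e v} → Δ G G (unfold e) v → Δ G G (μ e) v
  dId : ∀ {e} → G ≢ Id → Δ G Id e e
  dbc : ∀ {L b} → Δ G (K L) (bc L b) b
  dlp : ∀ {F H e v} → Δ G F e v → Δ G (F ⊠ H) l⟨ e ⟩ (v , Empty H)
  drp : ∀ {F H e v} → Δ G H e v → Δ G (F ⊠ H) r⟨ e ⟩ (Empty F , v)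
  dls : ∀ {F H e v} → Δ G F e v → Δ G (F ⊞ H) l[ e ] (κ₁ v)
  drs : ∀ {F H e v} → Δ G H e v → Δ G (F ⊞ H) r[ e ] (κ₂ v)
  dac : ∀ {F k a e v} → Δ G F e v →
        Δ G (F ^^ k) (act k a e) (λ a' → ifEq a a' v (Empty F))
  dsg : ∀ {F e v} → Δ G F e v → Δ G (𝒫 F) (sng e) (v ∷ [])

Lift : (F : Fun) → (Expr → Expr → Set) → ⟦ F ⟧ Expr → ⟦ F ⟧ Expr → Set
Lift Id R e e'                   = R e e'
Lift (K L) R b b'                = b ≡ b'
Lift (F ⊠ H) R (x , y) (x' , y') = Lift F R x x' × Lift H R y y'
Lift (F ⊞ H) R (κ₁ x) (κ₁ x')    = Lift F R x x'
Lift (F ⊞ H) R (κ₂ y) (κ₂ y')    = Lift H R y y'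
Lift (F ⊞ H) R ⊥ₛ ⊥ₛ             = ⊤'
Lift (F ⊞ H) R ⊤ₛ ⊤ₛ             = ⊤'
Lift (F ⊞ H) R _ _               = ⊥'
Lift (F ^^ k) R f g              = ∀ a → Lift F R (f a) (g a)
Lift (𝒫 F) R xs ys               =
  All (λ x → Any (λ y → Lift F R x y) ys) xs ×
  All (λ y → Any (λ x → Lift F R x y) xs) ys

IsBisim : (G : Fun) → (Expr → Expr → Set) → Set
IsBisim G R = ∀ e e' → R e e' →
  Exp G e × Exp G e' ×
  (∀ v v' → Δ G G e v → Δ G G e' v' → Lift G R v v')

_∼[_]_ : Expr → Fun → Expr → Set₁
e ∼[ G ] e' = Σ (Expr → Expr → Set) λ R → IsBisim G R × R e e'

-- Sorts: ⟪ F ⟫ is the sort of structured expressions of type F(Exp)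
-- (⟪ Id ⟫ is the sort Exp, ⟪ K L ⟫ a semilattice sort), and 𝔹 is the
-- sort of booleans used by the semilattice equality test _≃_.

data Sort : Set where
  ⟪_⟫ : Fun → Sort
  𝔹   : Sort

data Tm : Sort → Set where
  ex    : Expr → Tm ⟪ Id ⟫
  δ     : (F : Fun) → Tm ⟪ Id ⟫ → Tm ⟪ F ⟫
  emp   : (F : Fun) → Tm ⟪ F ⟫
  plus  : (F : Fun) → Tm ⟪ F ⟫ → Tm ⟪ F ⟫ → Tm ⟪ F ⟫
  cst   : (L : FJSL) → Fin (size L) → Tm ⟪ K L ⟫
  pair  : ∀ {F H} → Tm ⟪ F ⟫ → Tm ⟪ H ⟫ → Tm ⟪ F ⊠ H ⟫
  k₁    : ∀ {F H} → Tm ⟪ F ⟫ → Tm ⟪ F ⊞ H ⟫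
  k₂    : ∀ {F H} → Tm ⟪ H ⟫ → Tm ⟪ F ⊞ H ⟫
  ⊥t    : ∀ {F H} → Tm ⟪ F ⊞ H ⟫
  ⊤t    : ∀ {F H} → Tm ⟪ F ⊞ H ⟫
  fun   : ∀ {F k} → (Fin k → Tm ⟪ F ⟫) → Tm ⟪ F ^^ k ⟫
  app   : ∀ {F k} → Tm ⟪ F ^^ k ⟫ → Fin k → Tm ⟪ F ⟫
  set   : ∀ {F} → List (Tm ⟪ F ⟫) → Tm ⟪ 𝒫 F ⟫
  _≃_   : ∀ {L} → Tm ⟪ K L ⟫ → Tm ⟪ K L ⟫ → Tm 𝔹
  tru   : Tm 𝔹
  fls   : Tm 𝔹

data _≈x_ : Expr → Expr → Set where
  rfl   : ∀ {e} → e ≈x e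
  sym   : ∀ {e e'} → e ≈x e' → e' ≈x e
  trn   : ∀ {e e' e''} → e ≈x e' → e' ≈x e'' → e ≈x e''
  assoc : ∀ {a b c} → ((a ⊕ b) ⊕ c) ≈x (a ⊕ (b ⊕ c))
  comm  : ∀ {a b} → (a ⊕ b) ≈x (b ⊕ a)
  idem  : ∀ {a} → (a ⊕ a) ≈x a
  c⊕    : ∀ {a a' b b'} → a ≈x a' → b ≈x b' → (a ⊕ b) ≈x (a' ⊕ b')
  cμ    : ∀ {a a'} → a ≈x a' → μ a ≈x μ a'
  clp   : ∀ {a a'} → a ≈x a' → l⟨ a ⟩ ≈x l⟨ a' ⟩
  crp   : ∀ {a a'} → a ≈x a' → r⟨ a ⟩ ≈x r⟨ a' ⟩
  cls   : ∀ {a a'} → a ≈x a' → l[ a ] ≈x l[ a' ]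
  crs   : ∀ {a a'} → a ≈x a' → r[ a ] ≈x r[ a' ]
  cac   : ∀ {k b a a'} → a ≈x a' → act k b a ≈x act k b a'
  csg   : ∀ {a a'} → a ≈x a' → sng a ≈x sng a'

data _⊢E_≈_ (G : Fun) : ∀ {s} → Tm s → Tm s → Set where
  rfl   : ∀ {s} {t : Tm s} → G ⊢E t ≈ t
  sym   : ∀ {s} {t t' : Tm s} → G ⊢E t ≈ t' → G ⊢E t' ≈ t
  trn   : ∀ {s} {t t' t'' : Tm s} → G ⊢E t ≈ t' → G ⊢E t' ≈ t'' → G ⊢E t ≈ t''
  cex   : ∀ {e e'} → e ≈x e' → G ⊢E ex e ≈ ex e'
  cδ    : ∀ {F t t'} → G ⊢E t ≈ t' → G ⊢E δ F t ≈ δ F t'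
  cplus : ∀ {F t t' u u'} → G ⊢E t ≈ t' → G ⊢E u ≈ u' → G ⊢E plus F t u ≈ plus F t' u'
  cpair : ∀ {F H} {t t' : Tm ⟪ F ⟫} {u u' : Tm ⟪ H ⟫} →
          G ⊢E t ≈ t' → G ⊢E u ≈ u' → G ⊢E pair t u ≈ pair t' u'
  ck₁   : ∀ {F H} {t t' : Tm ⟪ F ⟫} → G ⊢E t ≈ t' → G ⊢E k₁ {F} {H} t ≈ k₁ t'
  ck₂   : ∀ {F H} {t t' : Tm ⟪ H ⟫} → G ⊢E t ≈ t' → G ⊢E k₂ {F} {H} t ≈ k₂ t'
  cfun  : ∀ {F k} {h h' : Fin k → Tm ⟪ F ⟫} → (∀ a → G ⊢E h a ≈ h' a) → G ⊢E fun h ≈ fun h'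
  capp  : ∀ {F k} {t t' : Tm ⟪ F ^^ k ⟫} {a} → G ⊢E t ≈ t' → G ⊢E app t a ≈ app t' a
  cset  : ∀ {F} {xs ys : List (Tm ⟪ F ⟫)} {x x'} → G ⊢E x ≈ x' →
          G ⊢E set (xs ++ x ∷ ys) ≈ set (xs ++ x' ∷ ys)
  c≃    : ∀ {L} {t t' u u' : Tm ⟪ K L ⟫} → G ⊢E t ≈ t' → G ⊢E u ≈ u' → G ⊢E (t ≃ u) ≈ (t' ≃ u')
  δ∅    : ∀ {F} → G ⊢E δ F (ex ∅) ≈ emp F
  δ⊕    : ∀ {F e e'} → ExpT G F (e ⊕ e') →
          G ⊢E δ F (ex (e ⊕ e')) ≈ plus F (δ F (ex e)) (δ F (ex e'))
  δμ    : ∀ {e} → ExpT G G (μ e) → G ⊢E δ G (ex (μ e)) ≈ δ G (ex (unfold e))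
  δId   : ∀ {e} → G ≢ Id → ExpT G Id e → G ⊢E δ Id (ex e) ≈ ex e
  δbc   : ∀ {L b} → G ⊢E δ (K L) (ex (bc L b)) ≈ cst L b
  δlp   : ∀ {F H e} → ExpT G F e → G ⊢E δ (F ⊠ H) (ex l⟨ e ⟩) ≈ pair (δ F (ex e)) (emp H)
  δrp   : ∀ {F H e} → ExpT G H e → G ⊢E δ (F ⊠ H) (ex r⟨ e ⟩) ≈ pair (emp F) (δ H (ex e))
  δls   : ∀ {F H e} → ExpT G F e → G ⊢E δ (F ⊞ H) (ex l[ e ]) ≈ k₁ (δ F (ex e))
  δrs   : ∀ {F H e} → ExpT G H e → G ⊢E δ (F ⊞ H) (ex r[ e ]) ≈ k₂ (δ H (ex e))
  δac   : ∀ {F k a e} → ExpT G F e →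
          G ⊢E δ (F ^^ k) (ex (act k a e)) ≈ fun (λ a' → ifEq a a' (δ F (ex e)) (emp F))
  δsg   : ∀ {F e} → ExpT G F e → G ⊢E δ (𝒫 F) (ex (sng e)) ≈ set (δ F (ex e) ∷ [])
  eId   : G ⊢E emp Id ≈ ex ∅
  eK    : ∀ {L} → G ⊢E emp (K L) ≈ cst L (bot L)
  e⊠    : ∀ {F H} → G ⊢E emp (F ⊠ H) ≈ pair (emp F) (emp H)
  e⊞    : ∀ {F H} → G ⊢E emp (F ⊞ H) ≈ ⊥t
  e^    : ∀ {F k} → G ⊢E emp (F ^^ k) ≈ fun (λ _ → emp F)
  e𝒫    : ∀ {F} → G ⊢E emp (𝒫 F) ≈ set []
  pId   : ∀ {e e'} → G ⊢E plus Id (ex e) (ex e') ≈ ex (e ⊕ e')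
  pK    : ∀ {L b b'} → G ⊢E plus (K L) (cst L b) (cst L b') ≈ cst L (join L b b')
  p⊠    : ∀ {F H a b a' b'} →
          G ⊢E plus (F ⊠ H) (pair a b) (pair a' b') ≈ pair (plus F a a') (plus H b b')
  p11   : ∀ {F H a a'} → G ⊢E plus (F ⊞ H) (k₁ a) (k₁ a') ≈ k₁ (plus F a a')
  p22   : ∀ {F H b b'} → G ⊢E plus (F ⊞ H) (k₂ b) (k₂ b') ≈ k₂ (plus H b b')
  p12   : ∀ {F H a b} → G ⊢E plus (F ⊞ H) (k₁ a) (k₂ b) ≈ ⊤t
  p21   : ∀ {F H a b} → G ⊢E plus (F ⊞ H) (k₂ b) (k₁ a) ≈ ⊤t
  p⊥l   : ∀ {F H t} → G ⊢E plus (F ⊞ H) ⊥t t ≈ t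
  p⊥r   : ∀ {F H t} → G ⊢E plus (F ⊞ H) t ⊥t ≈ t
  p⊤l   : ∀ {F H t} → G ⊢E plus (F ⊞ H) ⊤t t ≈ ⊤t
  p⊤r   : ∀ {F H t} → G ⊢E plus (F ⊞ H) t ⊤t ≈ ⊤t
  p^    : ∀ {F k f g} → G ⊢E plus (F ^^ k) f g ≈ fun (λ a → plus F (app f a) (app g a))
  p𝒫    : ∀ {F xs ys} → G ⊢E plus (𝒫 F) (set xs) (set ys) ≈ set (xs ++ ys)
  β     : ∀ {F k} {h : Fin k → Tm ⟪ F ⟫} {a} → G ⊢E app (fun h) a ≈ h a
  sperm : ∀ {F} {xs ys : List (Tm ⟪ F ⟫)} → xs ↭ ys → G ⊢E set xs ≈ set ys
  sdup  : ∀ {F} {x : Tm ⟪ F ⟫} {xs} → G ⊢E set (x ∷ x ∷ xs) ≈ set (x ∷ xs)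
  ≃t    : ∀ {L b} → G ⊢E (cst L b ≃ cst L b) ≈ tru
  ≃f    : ∀ {L b b'} → b ≢ b' → G ⊢E (cst L b ≃ cst L b') ≈ fls

-- Frozen equations  ⌈t⌉ = ⌈t'⌉  (frozen terms are not subterms of
-- anything, so hypotheses can only be used at the top).

FEq : Set
FEq = Σ Sort λ s → Tm s × Tm s

⌈_⌉ : Expr × Expr → FEq
⌈ e , e' ⌉ = ⟪ Id ⟫ , ex e , ex e'

δ[_] : Fun → Tm ⟪ Id ⟫ × Tm ⟪ Id ⟫ → FEq
δ[ G ] (t , t') = ⟪ G ⟫ , δ G t , δ G t'

_∈F_ : FEq → List FEq → Set
e ∈F Fs = Any (e ≡_) Fs

-- the interpolants of B_G, instantiated by a (ground) substitution θ,
-- matched modulo E_G:   Interp G e es  means  e ⇒ es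
data Interp (G : Fun) : FEq → List FEq → Set where
  ipair : ∀ {F H} {t t' : Tm ⟪ F ⊠ H ⟫} {a a' b b'} →
          G ⊢E t ≈ pair a b → G ⊢E t' ≈ pair a' b' →
          Interp G (⟪ F ⊠ H ⟫ , t , t') ((⟪ F ⟫ , a , a') ∷ (⟪ H ⟫ , b , b') ∷ [])
  ik₁   : ∀ {F H} {t t' : Tm ⟪ F ⊞ H ⟫} {a a'} →
          G ⊢E t ≈ k₁ a → G ⊢E t' ≈ k₁ a' →
          Interp G (⟪ F ⊞ H ⟫ , t , t') ((⟪ F ⟫ , a , a') ∷ [])
  ik₂   : ∀ {F H} {t t' : Tm ⟪ F ⊞ H ⟫} {b b'} →
          G ⊢E t ≈ k₂ b → G ⊢E t' ≈ k₂ b' →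
          Interp G (⟪ F ⊞ H ⟫ , t , t') ((⟪ H ⟫ , b , b') ∷ [])
  ifun  : ∀ {F k} {f g : Tm ⟪ F ^^ k ⟫} →
          Interp G (⟪ F ^^ k ⟫ , f , g) (map (λ a → ⟪ F ⟫ , app f a , app g a) (allFin k))
  iset  : ∀ {F} {t t' : Tm ⟪ 𝒫 F ⟫} {xs ys : List (Tm ⟪ F ⟫)} →
          G ⊢E t ≈ set xs → G ⊢E t' ≈ set ys →
          (c : Fin (length xs) → Fin (length ys)) →
          (d : Fin (length ys) → Fin (length xs)) →
          Interp G (⟪ 𝒫 F ⟫ , t , t')
            (map (λ i → ⟪ F ⟫ , lookup xs i , lookup ys (c i)) (allFin (length xs)) ++
             map (λ j → ⟪ F ⟫ , lookup xs (d j) , lookup ys j) (allFin (length ys)))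
  isl   : ∀ {L} {t t' : Tm ⟪ K L ⟫} →
          Interp G (⟪ K L ⟫ , t , t') ((𝔹 , (t ≃ t') , tru) ∷ [])

data Ent (G : Fun) (Hs : List FEq) : FEq → Set where
  byE   : ∀ {s} {t t' : Tm s} → G ⊢E t ≈ t' → Ent G Hs (s , t , t')
  hyp   : ∀ {e} → e ∈F Hs → Ent G Hs e
  sym   : ∀ {s} {t t' : Tm s} → Ent G Hs (s , t , t') → Ent G Hs (s , t' , t)
  trn   : ∀ {s} {t t' t'' : Tm s} →
          Ent G Hs (s , t , t') → Ent G Hs (s , t' , t'') → Ent G Hs (s , t , t'')
  dpair : ∀ {F H} {a a' : Tm ⟪ F ⟫} {b b' : Tm ⟪ H ⟫} →
          Ent G Hs (⟪ F ⟫ , a , a') → Ent G Hs (⟪ H ⟫ , b , b') →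
          Ent G Hs (⟪ F ⊠ H ⟫ , pair a b , pair a' b')
  dk₁   : ∀ {F H} {a a' : Tm ⟪ F ⟫} →
          Ent G Hs (⟪ F ⟫ , a , a') → Ent G Hs (⟪ F ⊞ H ⟫ , k₁ a , k₁ a')
  dk₂   : ∀ {F H} {b b' : Tm ⟪ H ⟫} →
          Ent G Hs (⟪ H ⟫ , b , b') → Ent G Hs (⟪ F ⊞ H ⟫ , k₂ b , k₂ b')
  dfun  : ∀ {F k} {h h' : Fin k → Tm ⟪ F ⟫} →
          (∀ a → Ent G Hs (⟪ F ⟫ , h a , h' a)) → Ent G Hs (⟪ F ^^ k ⟫ , fun h , fun h')
  dset  : ∀ {F} {xs ys : List (Tm ⟪ F ⟫)} →
          (∀ i → ∃ λ j → Ent G Hs (⟪ F ⟫ , lookup xs i , lookup ys j)) →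
          (∀ j → ∃ λ i → Ent G Hs (⟪ F ⟫ , lookup xs i , lookup ys j)) →
          Ent G Hs (⟪ 𝒫 F ⟫ , set xs , set ys)
  interp : ∀ {e es} → Interp G e es → All (Ent G Hs) es → Ent G Hs e

-- CIRC reduction on (hypotheses , goals)  (the specification B_G is fixed)

State : Set
State = List FEq × List FEq

data _⊢_⇒_ (G : Fun) : State → State → Set where
  reduce   : ∀ {Fs G₁ G₂ e} → Ent G Fs e →
             G ⊢ (Fs , G₁ ++ e ∷ G₂) ⇒ (Fs , G₁ ++ G₂)
  derive   : ∀ {Fs G₁ G₂} {t t' : Tm ⟪ Id ⟫} →
             ¬ Ent G Fs (⟪ Id ⟫ , t , t') →
             G ⊢ (Fs , G₁ ++ (⟪ Id ⟫ , t , t') ∷ G₂)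
               ⇒ ((⟪ Id ⟫ , t , t') ∷ Fs , G₁ ++ G₂ ++ δ[ G ] (t , t') ∷ [])
  simplify : ∀ {Fs G₁ G₂ e es} → Interp G e es →
             G ⊢ (Fs , G₁ ++ e ∷ G₂) ⇒ (Fs , G₁ ++ es ++ G₂)

-- Read every term of E_G as a value: a term of sort F denotes an element of F(Expr), where δ is
-- interpreted by a total derivative function that agrees with δ_{F◁G} on Exp_{F◁G}. Every equation
-- of E_G then holds up to ACI of ⊕, lifted through the functor. For a successful run, let ≋ be the
-- equivalence generated by ACI and the final hypotheses F_n. Everything entailed by B_G ∪ F_n holds up
-- to the lifting of ≋: frozen hypotheses are only used at the top, and the decomposition rules and
-- interpolants are sound for relation lifting. Each hypothesis entered F_n by [Derive], which made its
-- derivative a goal that was later discharged, so the derivative is entailed by F_n. Hence ≋-related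
-- expressions have lifted-≋-related derivatives, and ≋ restricted to Exp_G is a bisimulation that
-- contains all initial goals.
module Submission where

open import Defs
open import Data.Bool using (Bool; true; false; T)
open import Data.Empty using (⊥-elim)
open import Data.Fin using (Fin; _≟_)
open import Data.List using (List; []; _∷_; _++_; map; lookup; allFin)
open import Data.List.Membership.Propositional using (_∈_)
open import Data.List.Membership.Propositional.Properties using (∈-++⁺ˡ; ∈-++⁻)
open import Data.List.Properties using (++-assoc)
open import Data.List.Relation.Binary.Permutation.Propositional using (_↭_; refl; prep; swap; trans; ↭-sym)
open import Data.List.Relation.Binary.Permutation.Propositional.Properties using (∈-resp-↭; ++-comm)
open import Data.List.Relation.Binary.Subset.Propositional using (_⊆_)
open import Data.List.Relation.Unary.All as All using (All; []; _∷_)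
open import Data.List.Relation.Unary.All.Properties using (++⁺; ++⁻; ++⁻ʳ; map⁻; tabulate⁻)
open import Data.List.Relation.Unary.Any as Any using (Any; here; there)
open import Data.List.Relation.Unary.Any.Properties using (++⁺ˡ; ++⁺ʳ)
open import Data.Nat using (ℕ; zero; suc; _<_; _≤_; _⊔_; _≡ᵇ_; _<ᵇ_; z≤n; s≤s)
open import Data.Nat.Properties
  using (⊔-assoc; ⊔-comm; ⊔-idem; ≤-refl; ≤-pred; <-≤-trans; ≤∧≢⇒<; <ᵇ⇒<; <⇒<ᵇ; ≡⇒≡ᵇ;
         m⊔n≤o⇒m≤o; m⊔n≤o⇒n≤o; m≤m⊔n; m≤n⊔m)
  renaming (_≟_ to _≟ℕ_)
open import Data.Product using (_×_; _,_; ∃; proj₁; proj₂)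
open import Data.Sum using (_⊎_; inj₁; inj₂) renaming (reduce to merge)
open import Data.Unit using (tt) renaming (⊤ to ⊤')
open import Function using (_∘_)
open import Relation.Nullary using (Dec; yes; no; does)
open import Relation.Nullary.Decidable using (dec-true; dec-false)
open import Relation.Binary.PropositionalEquality
  using (_≡_; _≢_; refl; cong; cong₂; subst; subst₂) renaming (sym to ≡-sym; trans to ≡-trans)
open import Relation.Binary.Construct.Closure.ReflexiveTransitive using (Star; ε; _◅_)

μ-depth : Expr → ℕ
μ-depth (a ⊕ b) = μ-depth a ⊔ μ-depth b
μ-depth (μ a)   = suc (μ-depth a)
μ-depth _       = 0

μ-depth-cong : ∀ {a b} → a ≈x b → μ-depth a ≡ μ-depth b
μ-depth-cong rfl                 = refl
μ-depth-cong (sym p)             = ≡-sym (μ-depth-cong p)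
μ-depth-cong (trn p q)           = ≡-trans (μ-depth-cong p) (μ-depth-cong q)
μ-depth-cong (assoc {a} {b} {c}) = ⊔-assoc (μ-depth a) (μ-depth b) (μ-depth c)
μ-depth-cong (comm {a} {b})      = ⊔-comm (μ-depth a) (μ-depth b)
μ-depth-cong (idem {a})          = ⊔-idem (μ-depth a)
μ-depth-cong (c⊕ p q)            = cong₂ _⊔_ (μ-depth-cong p) (μ-depth-cong q)
μ-depth-cong (cμ p)              = cong suc (μ-depth-cong p)
μ-depth-cong (clp _)             = refl
μ-depth-cong (crp _)             = refl
μ-depth-cong (cls _)             = refl
μ-depth-cong (crs _)             = refl
μ-depth-cong (cac _)             = refl
μ-depth-cong (csg _)             = refl

μ-depth-sub : ∀ {n s a} → Gd a → μ-depth (sub n s a) ≡ μ-depth a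
μ-depth-sub ∅          = refl
μ-depth-sub (pl g g')  = cong₂ _⊔_ (μ-depth-sub g) (μ-depth-sub g')
μ-depth-sub (μ g)      = cong suc (μ-depth-sub g)
μ-depth-sub bc         = refl
μ-depth-sub lp         = refl
μ-depth-sub rp         = refl
μ-depth-sub ls         = refl
μ-depth-sub rs         = refl
μ-depth-sub ac         = refl
μ-depth-sub sg         = refl

Gd-sub : ∀ {n s a} → Gd a → Gd (sub n s a)
Gd-sub ∅         = ∅
Gd-sub (pl g g') = pl (Gd-sub g) (Gd-sub g')
Gd-sub (μ g)     = μ (Gd-sub g)
Gd-sub bc        = bc
Gd-sub lp        = lp
Gd-sub rp        = rp
Gd-sub ls        = ls
Gd-sub rs        = rs
Gd-sub ac        = ac
Gd-sub sg        = sg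

sub-var-elim : (P : Expr → Set) → ∀ n s m → P s → (∀ m' → P (var m')) → P (sub n s (var m))
sub-var-elim P n s m ps pv with m ≡ᵇ n
... | true = ps
... | false with m <ᵇ n
...   | true  = pv m
...   | false = pv _

WG-sub : ∀ {n s a} → WG s → WG a → WG (sub n s a)
WG-sub ws ∅              = ∅
WG-sub ws (pl w w')      = pl (WG-sub ws w) (WG-sub ws w')
WG-sub {n} {s} ws (vr {m}) = sub-var-elim WG n s m ws (λ _ → vr)
WG-sub ws (μ g w)        = μ (Gd-sub g) (WG-sub ws w)
WG-sub ws bc             = bc
WG-sub ws (lp w)         = lp (WG-sub ws w)
WG-sub ws (rp w)         = rp (WG-sub ws w)
WG-sub ws (ls w)         = ls (WG-sub ws w)
WG-sub ws (rs w)         = rs (WG-sub ws w)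
WG-sub ws (ac w)         = ac (WG-sub ws w)
WG-sub ws (sg w)         = sg (WG-sub ws w)

Ty-sub : ∀ {G F n s a} → Ty G s G → Ty G a F → Ty G (sub n s a) F
Ty-sub ts ∅                    = ∅
Ty-sub ts (pl t t')            = pl (Ty-sub ts t) (Ty-sub ts t')
Ty-sub {G} {n = n} {s} ts (vr {m}) = sub-var-elim (λ e → Ty G e G) n s m ts (λ _ → vr)
Ty-sub ts (μ t)                = μ (Ty-sub ts t)
Ty-sub ts (id t)               = id (Ty-sub ts t)
Ty-sub ts bc                   = bc
Ty-sub ts (lp t)               = lp (Ty-sub ts t)
Ty-sub ts (rp t)               = rp (Ty-sub ts t)
Ty-sub ts (ls t)               = ls (Ty-sub ts t)
Ty-sub ts (rs t)               = rs (Ty-sub ts t)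
Ty-sub ts (ac t)               = ac (Ty-sub ts t)
Ty-sub ts (sg t)               = sg (Ty-sub ts t)

Cl-weaken : ∀ {m n e} → m ≤ n → Cl m e → Cl n e
Cl-weaken le ∅         = ∅
Cl-weaken le (pl c c') = pl (Cl-weaken le c) (Cl-weaken le c')
Cl-weaken le (vr x)    = vr (<-≤-trans x le)
Cl-weaken le (μ c)     = μ (Cl-weaken (s≤s le) c)
Cl-weaken le bc        = bc
Cl-weaken le (lp c)    = lp (Cl-weaken le c)
Cl-weaken le (rp c)    = rp (Cl-weaken le c)
Cl-weaken le (ls c)    = ls (Cl-weaken le c)
Cl-weaken le (rs c)    = rs (Cl-weaken le c)
Cl-weaken le (ac c)    = ac (Cl-weaken le c)
Cl-weaken le (sg c)    = sg (Cl-weaken le c)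

Cl-sub : ∀ {n s a} → Cl 0 s → Cl (suc n) a → Cl n (sub n s a)
Cl-sub cs ∅         = ∅
Cl-sub cs (pl c c') = pl (Cl-sub cs c) (Cl-sub cs c')
Cl-sub {n} cs (vr {m} m<1+n) with m ≡ᵇ n in m≡ᵇn
... | true = Cl-weaken z≤n cs
... | false with m <ᵇ n in m<ᵇn
...   | true  = vr (<ᵇ⇒< m n (subst T (≡-sym m<ᵇn) _))
...   | false = ⊥-elim (subst T m<ᵇn (<⇒<ᵇ m<n))
  where
  m<n : m < n
  m<n = ≤∧≢⇒< (≤-pred m<1+n) λ m≡n → subst T m≡ᵇn (≡⇒≡ᵇ m n m≡n)
Cl-sub cs (μ c)     = μ (Cl-sub cs c)
Cl-sub cs bc        = bc
Cl-sub cs (lp c)    = lp (Cl-sub cs c)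
Cl-sub cs (rp c)    = rp (Cl-sub cs c)
Cl-sub cs (ls c)    = ls (Cl-sub cs c)
Cl-sub cs (rs c)    = rs (Cl-sub cs c)
Cl-sub cs (ac c)    = ac (Cl-sub cs c)
Cl-sub cs (sg c)    = sg (Cl-sub cs c)

unfold-Exp : ∀ {G e} → Exp G (μ e) → Exp G (unfold e)
unfold-Exp (μ c , μ g w , t) = Cl-sub (μ c) c , WG-sub (μ g w) w , Ty-sub t (Ty-μ⁻ t)
  where
  Ty-μ⁻ : ∀ {G e} → Ty G (μ e) G → Ty G e G
  Ty-μ⁻ (μ t)  = t
  Ty-μ⁻ (id t) = Ty-μ⁻ t

sub-congʳ : ∀ {n s s'} a → s ≈x s' → sub n s a ≈x sub n s' a
sub-congʳ ∅           p = rfl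
sub-congʳ (a ⊕ b)     p = c⊕ (sub-congʳ a p) (sub-congʳ b p)
sub-congʳ {n} (var m) p with m ≡ᵇ n
... | true  = p
... | false = rfl
sub-congʳ (μ a)       p = cμ (sub-congʳ a p)
sub-congʳ (bc L b)    p = rfl
sub-congʳ l⟨ a ⟩      p = clp (sub-congʳ a p)
sub-congʳ r⟨ a ⟩      p = crp (sub-congʳ a p)
sub-congʳ l[ a ]      p = cls (sub-congʳ a p)
sub-congʳ r[ a ]      p = crs (sub-congʳ a p)
sub-congʳ (act k x a) p = cac (sub-congʳ a p)
sub-congʳ (sng a)     p = csg (sub-congʳ a p)

sub-congˡ : ∀ {n s a a'} → a ≈x a' → sub n s a ≈x sub n s a'
sub-congˡ rfl       = rfl
sub-congˡ (sym p)   = sym (sub-congˡ p)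
sub-congˡ (trn p q) = trn (sub-congˡ p) (sub-congˡ q)
sub-congˡ assoc     = assoc
sub-congˡ comm      = comm
sub-congˡ idem      = idem
sub-congˡ (c⊕ p q)  = c⊕ (sub-congˡ p) (sub-congˡ q)
sub-congˡ (cμ p)    = cμ (sub-congˡ p)
sub-congˡ (clp p)   = clp (sub-congˡ p)
sub-congˡ (crp p)   = crp (sub-congˡ p)
sub-congˡ (cls p)   = cls (sub-congˡ p)
sub-congˡ (crs p)   = crs (sub-congˡ p)
sub-congˡ (cac p)   = cac (sub-congˡ p)
sub-congˡ (csg p)   = csg (sub-congˡ p)

unfold-cong : ∀ {a a'} → a ≈x a' → unfold a ≈x unfold a'
unfold-cong {a} p = trn (sub-congʳ a (cμ p)) (sub-congˡ p)

module _ {R : Expr → Expr → Set} where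

  Lift-refl : (∀ {e} → R e e) → ∀ F v → Lift F R v v
  Lift-refl r Id       v       = r
  Lift-refl r (K L)    v       = refl
  Lift-refl r (F ⊠ H)  (x , y) = Lift-refl r F x , Lift-refl r H y
  Lift-refl r (F ⊞ H)  (κ₁ x)  = Lift-refl r F x
  Lift-refl r (F ⊞ H)  (κ₂ x)  = Lift-refl r H x
  Lift-refl r (F ⊞ H)  ⊥ₛ      = tt
  Lift-refl r (F ⊞ H)  ⊤ₛ      = tt
  Lift-refl r (F ^^ k) f       = λ a → Lift-refl r F (f a)
  Lift-refl r (𝒫 F)    xs      =
    All.tabulate (Any.map λ { refl → Lift-refl r F _ }) , All.tabulate (Any.map λ { refl → Lift-refl r F _ })

  Lift-sym : (∀ {a b} → R a b → R b a) → ∀ F {v w} → Lift F R v w → Lift F R w v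
  Lift-sym s Id                        p       = s p
  Lift-sym s (K L)                     p       = ≡-sym p
  Lift-sym s (F ⊠ H) {_ , _} {_ , _}   (p , q) = Lift-sym s F p , Lift-sym s H q
  Lift-sym s (F ⊞ H) {κ₁ _} {κ₁ _}     p       = Lift-sym s F p
  Lift-sym s (F ⊞ H) {κ₂ _} {κ₂ _}     p       = Lift-sym s H p
  Lift-sym s (F ⊞ H) {⊥ₛ} {⊥ₛ}         p       = tt
  Lift-sym s (F ⊞ H) {⊤ₛ} {⊤ₛ}         p       = tt
  Lift-sym s (F ^^ k)                  p       = λ a → Lift-sym s F (p a)
  Lift-sym s (𝒫 F)                     (p , q) =
    All.map (Any.map (Lift-sym s F)) q , All.map (Any.map (Lift-sym s F)) p

  Lift-trans : (∀ {a b c} → R a b → R b c → R a c) →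
               ∀ F {u v w} → Lift F R u v → Lift F R v w → Lift F R u w
  Lift-trans t Id                             p       q         = t p q
  Lift-trans t (K L)                          p       q         = ≡-trans p q
  Lift-trans t (F ⊠ H) {_ , _} {_ , _} {_ , _} (p , q) (p' , q') =
    Lift-trans t F p p' , Lift-trans t H q q'
  Lift-trans t (F ⊞ H) {κ₁ _} {κ₁ _} {κ₁ _}   p       q         = Lift-trans t F p q
  Lift-trans t (F ⊞ H) {κ₂ _} {κ₂ _} {κ₂ _}   p       q         = Lift-trans t H p q
  Lift-trans t (F ⊞ H) {⊥ₛ} {⊥ₛ} {⊥ₛ}         p       q         = tt
  Lift-trans t (F ⊞ H) {⊤ₛ} {⊤ₛ} {⊤ₛ}         p       q         = tt
  Lift-trans t (F ^^ k)                       p       q         = λ a → Lift-trans t F (p a) (q a)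
  Lift-trans t (𝒫 F)                          (p , q) (p' , q') =
    All.map (All.lookupWith (λ yz xy → Any.map (Lift-trans t F xy) yz) p') p ,
    All.map (All.lookupWith (λ yx zy → Any.map (λ xy → Lift-trans t F xy zy) yx) q) q'

Lift-mono : ∀ {R R' : Expr → Expr → Set} → (∀ {a b} → R a b → R' a b) →
            ∀ F {v w} → Lift F R v w → Lift F R' v w
Lift-mono m Id                      p       = m p
Lift-mono m (K L)                   p       = p
Lift-mono m (F ⊠ H) {_ , _} {_ , _} (p , q) = Lift-mono m F p , Lift-mono m H q
Lift-mono m (F ⊞ H) {κ₁ _} {κ₁ _}   p       = Lift-mono m F p
Lift-mono m (F ⊞ H) {κ₂ _} {κ₂ _}   p       = Lift-mono m H p
Lift-mono m (F ⊞ H) {⊥ₛ} {⊥ₛ}       p       = tt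
Lift-mono m (F ⊞ H) {⊤ₛ} {⊤ₛ}       p       = tt
Lift-mono m (F ^^ k)                p       = λ a → Lift-mono m F (p a)
Lift-mono m (𝒫 F)                   (p , q) =
  All.map (Any.map (Lift-mono m F)) p , All.map (Any.map (Lift-mono m F)) q

Lift≈ : (F : Fun) → ⟦ F ⟧ Expr → ⟦ F ⟧ Expr → Set
Lift≈ F = Lift F _≈x_

Lift≈-refl : ∀ F v → Lift≈ F v v
Lift≈-refl = Lift-refl rfl

Lift≈-sym : ∀ F {v w} → Lift≈ F v w → Lift≈ F w v
Lift≈-sym = Lift-sym sym

Lift≈-trans : ∀ F {u v w} → Lift≈ F u v → Lift≈ F v w → Lift≈ F u w
Lift≈-trans = Lift-trans trn

Lift≈-reflexive : ∀ F {v w} → v ≡ w → Lift≈ F v w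
Lift≈-reflexive F refl = Lift≈-refl F _

Lift≈-sameElements : ∀ F {xs ys : List (⟦ F ⟧ Expr)} → xs ⊆ ys → ys ⊆ xs → Lift≈ (𝒫 F) xs ys
Lift≈-sameElements F xs⊆ys ys⊆xs =
  All.tabulate (λ x∈xs → Any.map (λ { refl → Lift≈-refl F _ }) (xs⊆ys x∈xs)) ,
  All.tabulate (λ y∈ys → Any.map (λ { refl → Lift≈-refl F _ }) (ys⊆xs y∈ys))

Lift≈-singleton : ∀ F {x y} → Lift≈ F x y → Lift≈ (𝒫 F) (x ∷ []) (y ∷ [])
Lift≈-singleton F x≈y = here x≈y ∷ [] , here x≈y ∷ []

Lift≈-↭ : ∀ F {xs ys : List (⟦ F ⟧ Expr)} → xs ↭ ys → Lift≈ (𝒫 F) xs ys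
Lift≈-↭ F p = Lift≈-sameElements F (∈-resp-↭ p) (∈-resp-↭ (↭-sym p))

Plus-cong : ∀ F {x x' y y'} → Lift≈ F x x' → Lift≈ F y y' → Lift≈ F (Plus F x y) (Plus F x' y')
Plus-cong Id p q = c⊕ p q
Plus-cong (K L) p q = cong₂ (FJSL.join L) p q
Plus-cong (F ⊠ H) {_ , _} {_ , _} {_ , _} {_ , _} (p , q) (p' , q') = Plus-cong F p p' , Plus-cong H q q'
Plus-cong (F ⊞ H) {κ₁ _} {κ₁ _} {κ₁ _} {κ₁ _} p q = Plus-cong F p q
Plus-cong (F ⊞ H) {κ₁ _} {κ₁ _} {κ₂ _} {κ₂ _} p q = tt
Plus-cong (F ⊞ H) {κ₁ _} {κ₁ _} {⊥ₛ}   {⊥ₛ}   p q = p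
Plus-cong (F ⊞ H) {κ₁ _} {κ₁ _} {⊤ₛ}   {⊤ₛ}   p q = tt
Plus-cong (F ⊞ H) {κ₂ _} {κ₂ _} {κ₁ _} {κ₁ _} p q = tt
Plus-cong (F ⊞ H) {κ₂ _} {κ₂ _} {κ₂ _} {κ₂ _} p q = Plus-cong H p q
Plus-cong (F ⊞ H) {κ₂ _} {κ₂ _} {⊥ₛ}   {⊥ₛ}   p q = p
Plus-cong (F ⊞ H) {κ₂ _} {κ₂ _} {⊤ₛ}   {⊤ₛ}   p q = tt
Plus-cong (F ⊞ H) {⊥ₛ}   {⊥ₛ}                 p q = q
Plus-cong (F ⊞ H) {⊤ₛ}   {⊤ₛ}                 p q = tt
Plus-cong (F ^^ k) p q = λ a → Plus-cong F (p a) (q a)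
Plus-cong (𝒫 F) {xs} {xs'} {ys} {ys'} (p , p') (q , q') =
  ++⁺ (All.map ++⁺ˡ p) (All.map (++⁺ʳ xs') q) , ++⁺ (All.map ++⁺ˡ p') (All.map (++⁺ʳ xs) q')

Plus-comm : ∀ F x y → Lift≈ F (Plus F x y) (Plus F y x)
Plus-comm Id x y = comm
Plus-comm (K L) x y = FJSL.comm L x y
Plus-comm (F ⊠ H) (x , y) (x' , y') = Plus-comm F x x' , Plus-comm H y y'
Plus-comm (F ⊞ H) (κ₁ x) (κ₁ y) = Plus-comm F x y
Plus-comm (F ⊞ H) (κ₁ x) (κ₂ y) = tt
Plus-comm (F ⊞ H) (κ₁ x) ⊥ₛ     = Lift≈-refl F x
Plus-comm (F ⊞ H) (κ₁ x) ⊤ₛ     = tt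
Plus-comm (F ⊞ H) (κ₂ x) (κ₁ y) = tt
Plus-comm (F ⊞ H) (κ₂ x) (κ₂ y) = Plus-comm H x y
Plus-comm (F ⊞ H) (κ₂ x) ⊥ₛ     = Lift≈-refl H x
Plus-comm (F ⊞ H) (κ₂ x) ⊤ₛ     = tt
Plus-comm (F ⊞ H) ⊥ₛ     (κ₁ y) = Lift≈-refl F y
Plus-comm (F ⊞ H) ⊥ₛ     (κ₂ y) = Lift≈-refl H y
Plus-comm (F ⊞ H) ⊥ₛ     ⊥ₛ     = tt
Plus-comm (F ⊞ H) ⊥ₛ     ⊤ₛ     = tt
Plus-comm (F ⊞ H) ⊤ₛ     (κ₁ y) = tt
Plus-comm (F ⊞ H) ⊤ₛ     (κ₂ y) = tt
Plus-comm (F ⊞ H) ⊤ₛ     ⊥ₛ     = tt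
Plus-comm (F ⊞ H) ⊤ₛ     ⊤ₛ     = tt
Plus-comm (F ^^ k) f g = λ a → Plus-comm F (f a) (g a)
Plus-comm (𝒫 F) xs ys = Lift≈-↭ F (++-comm xs ys)

Plus-idem : ∀ F x → Lift≈ F (Plus F x x) x
Plus-idem Id x = idem
Plus-idem (K L) x = FJSL.idem L x
Plus-idem (F ⊠ H) (x , y) = Plus-idem F x , Plus-idem H y
Plus-idem (F ⊞ H) (κ₁ x) = Plus-idem F x
Plus-idem (F ⊞ H) (κ₂ x) = Plus-idem H x
Plus-idem (F ⊞ H) ⊥ₛ = tt
Plus-idem (F ⊞ H) ⊤ₛ = tt
Plus-idem (F ^^ k) f = λ a → Plus-idem F (f a)
Plus-idem (𝒫 F) xs = Lift≈-sameElements F (merge ∘ ∈-++⁻ xs) ∈-++⁺ˡ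

Plus-assoc : ∀ F x y z → Lift≈ F (Plus F (Plus F x y) z) (Plus F x (Plus F y z))
Plus-assoc Id x y z = assoc
Plus-assoc (K L) x y z = FJSL.assoc L x y z
Plus-assoc (F ⊠ H) (x , y) (x' , y') (x'' , y'') = Plus-assoc F x x' x'' , Plus-assoc H y y' y''
Plus-assoc (F ⊞ H) ⊥ₛ     y      z      = Lift≈-refl (F ⊞ H) (Plus (F ⊞ H) y z)
Plus-assoc (F ⊞ H) ⊤ₛ     y      z      = tt
Plus-assoc (F ⊞ H) (κ₁ x) ⊥ₛ     z      = Lift≈-refl (F ⊞ H) (Plus (F ⊞ H) (κ₁ x) z)
Plus-assoc (F ⊞ H) (κ₁ x) ⊤ₛ     z      = tt
Plus-assoc (F ⊞ H) (κ₁ x) (κ₁ y) (κ₁ z) = Plus-assoc F x y z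
Plus-assoc (F ⊞ H) (κ₁ x) (κ₁ y) (κ₂ z) = tt
Plus-assoc (F ⊞ H) (κ₁ x) (κ₁ y) ⊥ₛ     = Lift≈-refl F (Plus F x y)
Plus-assoc (F ⊞ H) (κ₁ x) (κ₁ y) ⊤ₛ     = tt
Plus-assoc (F ⊞ H) (κ₁ x) (κ₂ y) (κ₁ z) = tt
Plus-assoc (F ⊞ H) (κ₁ x) (κ₂ y) (κ₂ z) = tt
Plus-assoc (F ⊞ H) (κ₁ x) (κ₂ y) ⊥ₛ     = tt
Plus-assoc (F ⊞ H) (κ₁ x) (κ₂ y) ⊤ₛ     = tt
Plus-assoc (F ⊞ H) (κ₂ x) ⊥ₛ     z      = Lift≈-refl (F ⊞ H) (Plus (F ⊞ H) (κ₂ x) z)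
Plus-assoc (F ⊞ H) (κ₂ x) ⊤ₛ     z      = tt
Plus-assoc (F ⊞ H) (κ₂ x) (κ₁ y) (κ₁ z) = tt
Plus-assoc (F ⊞ H) (κ₂ x) (κ₁ y) (κ₂ z) = tt
Plus-assoc (F ⊞ H) (κ₂ x) (κ₁ y) ⊥ₛ     = tt
Plus-assoc (F ⊞ H) (κ₂ x) (κ₁ y) ⊤ₛ     = tt
Plus-assoc (F ⊞ H) (κ₂ x) (κ₂ y) (κ₁ z) = tt
Plus-assoc (F ⊞ H) (κ₂ x) (κ₂ y) (κ₂ z) = Plus-assoc H x y z
Plus-assoc (F ⊞ H) (κ₂ x) (κ₂ y) ⊥ₛ     = Lift≈-refl H (Plus H x y)
Plus-assoc (F ⊞ H) (κ₂ x) (κ₂ y) ⊤ₛ     = tt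
Plus-assoc (F ^^ k) f g h = λ a → Plus-assoc F (f a) (g a) (h a)
Plus-assoc (𝒫 F) xs ys zs = Lift≈-reflexive (𝒫 F) (++-assoc xs ys zs)

Plus-⊥ʳ : ∀ F H (x : ⟦ F ⊞ H ⟧ Expr) → Lift≈ (F ⊞ H) (Plus (F ⊞ H) x ⊥ₛ) x
Plus-⊥ʳ F H (κ₁ x) = Lift≈-refl F x
Plus-⊥ʳ F H (κ₂ x) = Lift≈-refl H x
Plus-⊥ʳ F H ⊥ₛ     = tt
Plus-⊥ʳ F H ⊤ₛ     = tt

Plus-⊤ʳ : ∀ F H (x : ⟦ F ⊞ H ⟧ Expr) → Lift≈ (F ⊞ H) (Plus (F ⊞ H) x ⊤ₛ) ⊤ₛ
Plus-⊤ʳ F H (κ₁ x) = tt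
Plus-⊤ʳ F H (κ₂ x) = tt
Plus-⊤ʳ F H ⊥ₛ     = tt
Plus-⊤ʳ F H ⊤ₛ     = tt

Ty-⊕⁻ : ∀ {G F a b} → Ty G (a ⊕ b) F → Ty G a F × Ty G b F
Ty-⊕⁻ (pl t t') = t , t'
Ty-⊕⁻ (id t)    = let t₁ , t₂ = Ty-⊕⁻ t in id t₁ , id t₂

Ty-Id⁻ : ∀ {G e} → Ty G e Id → Ty G e G
Ty-Id⁻ ∅         = ∅
Ty-Id⁻ (pl t t') = pl (Ty-Id⁻ t) (Ty-Id⁻ t')
Ty-Id⁻ vr        = vr
Ty-Id⁻ (μ t)     = μ t
Ty-Id⁻ (id t)    = t

Typed : (G F : Fun) → ⟦ F ⟧ Expr → Set
Typed G Id       e       = Exp G e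
Typed G (K L)    _       = ⊤'
Typed G (F ⊠ H)  (x , y) = Typed G F x × Typed G H y
Typed G (F ⊞ H)  (κ₁ x)  = Typed G F x
Typed G (F ⊞ H)  (κ₂ y)  = Typed G H y
Typed G (F ⊞ H)  ⊥ₛ      = ⊤'
Typed G (F ⊞ H)  ⊤ₛ      = ⊤'
Typed G (F ^^ k) f       = ∀ a → Typed G F (f a)
Typed G (𝒫 F)    xs      = All (Typed G F) xs

Empty-Typed : ∀ {G} F → Typed G F (Empty F)
Empty-Typed Id       = ∅ , ∅ , ∅
Empty-Typed (K L)    = tt
Empty-Typed (F ⊠ H)  = Empty-Typed F , Empty-Typed H
Empty-Typed (F ⊞ H)  = tt
Empty-Typed (F ^^ k) = λ _ → Empty-Typed F
Empty-Typed (𝒫 F)    = []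

Plus-Typed : ∀ {G} F {x y} → Typed G F x → Typed G F y → Typed G F (Plus F x y)
Plus-Typed Id (c , w , t) (c' , w' , t') = pl c c' , pl w w' , pl t t'
Plus-Typed (K L) _ _ = tt
Plus-Typed (F ⊠ H) {_ , _} {_ , _} (p , q) (p' , q') = Plus-Typed F p p' , Plus-Typed H q q'
Plus-Typed (F ⊞ H) {κ₁ _} {κ₁ _} p q = Plus-Typed F p q
Plus-Typed (F ⊞ H) {κ₁ _} {κ₂ _} p q = tt
Plus-Typed (F ⊞ H) {κ₁ _} {⊥ₛ}   p q = p
Plus-Typed (F ⊞ H) {κ₁ _} {⊤ₛ}   p q = tt
Plus-Typed (F ⊞ H) {κ₂ _} {κ₁ _} p q = tt
Plus-Typed (F ⊞ H) {κ₂ _} {κ₂ _} p q = Plus-Typed H p q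
Plus-Typed (F ⊞ H) {κ₂ _} {⊥ₛ}   p q = p
Plus-Typed (F ⊞ H) {κ₂ _} {⊤ₛ}   p q = tt
Plus-Typed (F ⊞ H) {⊥ₛ}          p q = q
Plus-Typed (F ⊞ H) {⊤ₛ}          p q = tt
Plus-Typed (F ^^ k) p q = λ a → Plus-Typed F (p a) (q a)
Plus-Typed (𝒫 F) p q = ++⁺ p q

ifEq-elim : ∀ {k} {A : Set} (P : A → Set) (a a' : Fin k) {x y} → P x → P y → P (ifEq a a' x y)
ifEq-elim P a a' px py with a ≟ a'
... | yes _ = px
... | no _  = py

Δ-Typed : ∀ {G F e v} → ExpT G F e → Δ G F e v → Typed G F v
Δ-Typed {F = F} _ d∅ = Empty-Typed F
Δ-Typed {F = F} (pl c c' , pl w w' , t) (d⊕ d d') =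
  let t₁ , t₂ = Ty-⊕⁻ t in Plus-Typed F (Δ-Typed (c , w , t₁) d) (Δ-Typed (c' , w' , t₂) d')
Δ-Typed x                      (dμ d)  = Δ-Typed (unfold-Exp x) d
Δ-Typed (c , w , t)            (dId _) = c , w , Ty-Id⁻ t
Δ-Typed _                      dbc     = tt
Δ-Typed (lp c , lp w , lp t)   (dlp {H = H} d) = Δ-Typed (c , w , t) d , Empty-Typed H
Δ-Typed (rp c , rp w , rp t)   (drp {F = F} d) = Empty-Typed F , Δ-Typed (c , w , t) d
Δ-Typed (ls c , ls w , ls t)   (dls d) = Δ-Typed (c , w , t) d
Δ-Typed (rs c , rs w , rs t)   (drs d) = Δ-Typed (c , w , t) d
Δ-Typed {G} (ac c , ac w , ac t) (dac {F} {a = a} d) a' =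
  ifEq-elim (Typed G F) a a' (Δ-Typed (c , w , t) d) (Empty-Typed F)
Δ-Typed (sg c , sg w , sg t)   (dsg d) = Δ-Typed (c , w , t) d ∷ []

_≟Id : (G : Fun) → Dec (G ≡ Id)
Id       ≟Id = yes refl
(K _)    ≟Id = no λ ()
(_ ⊠ _)  ≟Id = no λ ()
(_ ⊞ _)  ≟Id = no λ ()
(_ ^^ _) ≟Id = no λ ()
(𝒫 _)    ≟Id = no λ ()

-- Recursion on F, then on the fuel n bounding the μ-unfoldings, then on the typing derivation.
Δ-total-at : ∀ {G} F n {e} → μ-depth e ≤ n → Cl 0 e → WG e → Ty G e F → ∃ (Δ G F e)
Δ-total-at F n le c w ∅ = _ , d∅
Δ-total-at F n {a ⊕ b} le (pl c c') (pl w w') (pl t t') =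
  _ , d⊕ (proj₂ (Δ-total-at F n (m⊔n≤o⇒m≤o (μ-depth a) (μ-depth b) le) c w t))
         (proj₂ (Δ-total-at F n (m⊔n≤o⇒n≤o (μ-depth a) (μ-depth b) le) c' w' t'))
Δ-total-at F n le (vr ()) w vr
Δ-total-at F (suc n) {μ a} le (μ c) (μ g w) (μ t) =
  _ , dμ (proj₂ (Δ-total-at F n (subst (_≤ n) (≡-sym (μ-depth-sub g)) (≤-pred le))
                       (Cl-sub (μ c) c) (WG-sub (μ g w) w) (Ty-sub (μ t) t)))
Δ-total-at {Id}     Id n le c w (id t) = Δ-total-at Id n le c w t
Δ-total-at {K _}    Id n le c w (id t) = _ , dId λ ()
Δ-total-at {_ ⊠ _}  Id n le c w (id t) = _ , dId λ ()
Δ-total-at {_ ⊞ _}  Id n le c w (id t) = _ , dId λ ()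
Δ-total-at {_ ^^ _} Id n le c w (id t) = _ , dId λ ()
Δ-total-at {𝒫 _}    Id n le c w (id t) = _ , dId λ ()
Δ-total-at F n le c w bc = _ , dbc
Δ-total-at (F ⊠ H)  n le (lp c) (lp w) (lp t) = _ , dlp (proj₂ (Δ-total-at F _ ≤-refl c w t))
Δ-total-at (F ⊠ H)  n le (rp c) (rp w) (rp t) = _ , drp (proj₂ (Δ-total-at H _ ≤-refl c w t))
Δ-total-at (F ⊞ H)  n le (ls c) (ls w) (ls t) = _ , dls (proj₂ (Δ-total-at F _ ≤-refl c w t))
Δ-total-at (F ⊞ H)  n le (rs c) (rs w) (rs t) = _ , drs (proj₂ (Δ-total-at H _ ≤-refl c w t))
Δ-total-at (F ^^ k) n le (ac c) (ac w) (ac t) = _ , dac (proj₂ (Δ-total-at F _ ≤-refl c w t))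
Δ-total-at (𝒫 F)    n le (sg c) (sg w) (sg t) = _ , dsg (proj₂ (Δ-total-at F _ ≤-refl c w t))

Δ-total : ∀ {G F e} → ExpT G F e → ∃ (Δ G F e)
Δ-total {F = F} {e} (c , w , t) = Δ-total-at F (μ-depth e) ≤-refl c w t

-- Constants b and actions a(ε) carry their own semilattice or alphabet; typing forces it to be the
-- one of F, and otherwise the default is a junk value.
transportOr : (P : ℕ → Set) → ∀ {m n} → P n → P m → P n
transportOr P {m} {n} default x with m ≟ℕ n
... | yes refl = x
... | no _     = default

transportOr-refl : ∀ (P : ℕ → Set) {n} (default x : P n) → transportOr P default x ≡ x
transportOr-refl P {n} _ _ with n ≟ℕ n
... | yes refl  = refl
... | no n≢n    = ⊥-elim (n≢n refl)

transportOr-cong : ∀ (P : ℕ → Set) (R : ∀ {n} → P n → P n → Set) {m n} {default : P n} {x y : P m} →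
                   R default default → R x y → R (transportOr P default x) (transportOr P default y)
transportOr-cong P R {m} {n} r-default rxy with m ≟ℕ n
... | yes refl = rxy
... | no _     = r-default

ifEq-cong : ∀ F {k} (a a' : Fin k) {x x' y} → Lift≈ F x x' → Lift≈ F (ifEq a a' x y) (ifEq a a' x' y)
ifEq-cong F a a' x≈x' with a ≟ a'
... | yes _ = x≈x'
... | no _  = Lift≈-refl F _

-- δ_{Id◁G} is the identity when G ≠ Id; for G = Id the remaining cases are variables and ill-typed
-- expressions, where ∅ is junk.
identityUnlessId : Fun → Expr → Expr
identityUnlessId Id _ = ∅
identityUnlessId _  e = e

-- The fuel bounds the number of μ-unfoldings before a guard; μ-depth is enough on guarded
-- expressions (deriv-stable), and on ill-typed expressions the result is junk.
deriv : (F G : Fun) → ℕ → Expr → ⟦ F ⟧ Expr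
deriv F G n       ∅       = Empty F
deriv F G n       (a ⊕ b) = Plus F (deriv F G n a) (deriv F G n b)
deriv Id Id zero    (μ a) = ∅
deriv Id Id (suc n) (μ a) = deriv Id Id n (unfold a)
deriv Id G n      e       = identityUnlessId G e
deriv F G zero    (μ a)   = Empty F
deriv F G (suc n) (μ a)   = deriv F G n (unfold a)
deriv (K L)    G _ (bc _ b)      = transportOr Fin (FJSL.bot L) b
deriv (F ⊠ H)  G _ l⟨ e ⟩        = deriv F G (μ-depth e) e , Empty H
deriv (F ⊠ H)  G _ r⟨ e ⟩        = Empty F , deriv H G (μ-depth e) e
deriv (F ⊞ H)  G _ l[ e ]        = κ₁ (deriv F G (μ-depth e) e)
deriv (F ⊞ H)  G _ r[ e ]        = κ₂ (deriv H G (μ-depth e) e)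
deriv (F ^^ k) G _ (act _ a e)   =
  transportOr (λ j → Fin j → ⟦ F ⟧ Expr) (λ _ → Empty F) (λ a' → ifEq a a' (deriv F G (μ-depth e) e) (Empty F))
deriv (𝒫 F)    G _ (sng e)       = deriv F G (μ-depth e) e ∷ []
deriv F        G _ _             = Empty F

derivative : (F G : Fun) → Expr → ⟦ F ⟧ Expr
derivative F G e = deriv F G (μ-depth e) e

deriv-μ : ∀ G n a → deriv G G (suc n) (μ a) ≡ deriv G G n (unfold a)
deriv-μ Id       _ _ = refl
deriv-μ (K _)    _ _ = refl
deriv-μ (_ ⊠ _)  _ _ = refl
deriv-μ (_ ⊞ _)  _ _ = refl
deriv-μ (_ ^^ _) _ _ = refl
deriv-μ (𝒫 _)    _ _ = refl

identityUnlessId-≢ : ∀ {G} e → G ≢ Id → identityUnlessId G e ≡ e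
identityUnlessId-≢ {Id} _ G≢Id = ⊥-elim (G≢Id refl)
identityUnlessId-≢ {K _}    _ _ = refl
identityUnlessId-≢ {_ ⊠ _}  _ _ = refl
identityUnlessId-≢ {_ ⊞ _}  _ _ = refl
identityUnlessId-≢ {_ ^^ _} _ _ = refl
identityUnlessId-≢ {𝒫 _}    _ _ = refl

deriv-Id : ∀ {G} → G ≢ Id → ∀ n e → deriv Id G n e ≡ e
deriv-Id G≢Id n ∅           = refl
deriv-Id G≢Id n (a ⊕ b)     = cong₂ _⊕_ (deriv-Id G≢Id n a) (deriv-Id G≢Id n b)
deriv-Id {Id} G≢Id _ (μ _)  = ⊥-elim (G≢Id refl)
deriv-Id {K _}    _ _ (μ _) = refl
deriv-Id {_ ⊠ _}  _ _ (μ _) = refl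
deriv-Id {_ ⊞ _}  _ _ (μ _) = refl
deriv-Id {_ ^^ _} _ _ (μ _) = refl
deriv-Id {𝒫 _}    _ _ (μ _) = refl
deriv-Id G≢Id n (var _)     = identityUnlessId-≢ _ G≢Id
deriv-Id G≢Id n (bc _ _)    = identityUnlessId-≢ _ G≢Id
deriv-Id G≢Id n l⟨ _ ⟩      = identityUnlessId-≢ _ G≢Id
deriv-Id G≢Id n r⟨ _ ⟩      = identityUnlessId-≢ _ G≢Id
deriv-Id G≢Id n l[ _ ]      = identityUnlessId-≢ _ G≢Id
deriv-Id G≢Id n r[ _ ]      = identityUnlessId-≢ _ G≢Id
deriv-Id G≢Id n (act _ _ _) = identityUnlessId-≢ _ G≢Id
deriv-Id G≢Id n (sng _)     = identityUnlessId-≢ _ G≢Id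

Δ⇒deriv : ∀ {G F e v} → Δ G F e v → WG e → ∀ {n} → μ-depth e ≤ n → deriv F G n e ≡ v
Δ⇒deriv d∅ _ _ = refl
Δ⇒deriv {F = F} {a ⊕ b} (d⊕ da db) (pl wa wb) le =
  cong₂ (Plus F) (Δ⇒deriv da wa (m⊔n≤o⇒m≤o (μ-depth a) (μ-depth b) le))
                 (Δ⇒deriv db wb (m⊔n≤o⇒n≤o (μ-depth a) (μ-depth b) le))
Δ⇒deriv {G} {e = μ a} (dμ d) (μ g w) {suc n} le =
  ≡-trans (deriv-μ G n a) (Δ⇒deriv d (WG-sub (μ g w) w) (subst (_≤ n) (≡-sym (μ-depth-sub g)) (≤-pred le)))
Δ⇒deriv {e = e} (dId G≢Id) _ {n} _ = deriv-Id G≢Id n e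
Δ⇒deriv (dbc {L} {b}) _ _ = transportOr-refl Fin (FJSL.bot L) b
Δ⇒deriv (dlp d) (lp w) _ = cong (_, _) (Δ⇒deriv d w ≤-refl)
Δ⇒deriv (drp d) (rp w) _ = cong (_ ,_) (Δ⇒deriv d w ≤-refl)
Δ⇒deriv (dls d) (ls w) _ = cong κ₁ (Δ⇒deriv d w ≤-refl)
Δ⇒deriv (drs d) (rs w) _ = cong κ₂ (Δ⇒deriv d w ≤-refl)
Δ⇒deriv (dac {F} {a = a} d) (ac w) _ =
  ≡-trans (transportOr-refl (λ j → Fin j → ⟦ F ⟧ Expr) _ _)
          (cong (λ v a' → ifEq a a' v (Empty F)) (Δ⇒deriv d w ≤-refl))
Δ⇒deriv (dsg d) (sg w) _ = cong (_∷ []) (Δ⇒deriv d w ≤-refl)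

deriv-stable : ∀ {G F e} → ExpT G F e → ∀ {n} → μ-depth e ≤ n → deriv F G n e ≡ derivative F G e
deriv-stable x@(_ , w , _) le with Δ-total x
... | _ , d = ≡-trans (Δ⇒deriv d w le) (≡-sym (Δ⇒deriv d w ≤-refl))

deriv-Id-Id-cong : ∀ n {e e'} → e ≈x e' → deriv Id Id n e ≈x deriv Id Id n e'
deriv-Id-Id-cong n       rfl       = rfl
deriv-Id-Id-cong n       (sym p)   = sym (deriv-Id-Id-cong n p)
deriv-Id-Id-cong n       (trn p q) = trn (deriv-Id-Id-cong n p) (deriv-Id-Id-cong n q)
deriv-Id-Id-cong n       assoc     = assoc
deriv-Id-Id-cong n       comm      = comm
deriv-Id-Id-cong n       idem      = idem
deriv-Id-Id-cong n       (c⊕ p q)  = c⊕ (deriv-Id-Id-cong n p) (deriv-Id-Id-cong n q)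
deriv-Id-Id-cong zero    (cμ p)    = rfl
deriv-Id-Id-cong (suc n) (cμ p)    = deriv-Id-Id-cong n (unfold-cong p)
deriv-Id-Id-cong n       (clp p)   = rfl
deriv-Id-Id-cong n       (crp p)   = rfl
deriv-Id-Id-cong n       (cls p)   = rfl
deriv-Id-Id-cong n       (crs p)   = rfl
deriv-Id-Id-cong n       (cac p)   = rfl
deriv-Id-Id-cong n       (csg p)   = rfl

deriv-Id-cong : ∀ G n {e e'} → e ≈x e' → deriv Id G n e ≈x deriv Id G n e'
deriv-Id-cong G n {e} {e'} p with G ≟Id
... | yes refl = deriv-Id-Id-cong n p
... | no G≢Id  = subst₂ _≈x_ (≡-sym (deriv-Id G≢Id n e)) (≡-sym (deriv-Id G≢Id n e')) p

mutual
  deriv-cong : ∀ F G n {e e'} → e ≈x e' → Lift≈ F (deriv F G n e) (deriv F G n e')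
  deriv-cong Id G n p = deriv-Id-cong G n p
  deriv-cong F G n rfl       = Lift≈-refl F _
  deriv-cong F G n (sym p)   = Lift≈-sym F (deriv-cong F G n p)
  deriv-cong F G n (trn p q) = Lift≈-trans F (deriv-cong F G n p) (deriv-cong F G n q)
  deriv-cong F G n assoc     = Plus-assoc F _ _ _
  deriv-cong F G n comm      = Plus-comm F _ _
  deriv-cong F G n idem      = Plus-idem F _
  deriv-cong F G n (c⊕ p q)  = Plus-cong F (deriv-cong F G n p) (deriv-cong F G n q)
  deriv-cong F G n (cμ p)    = deriv-cong-μ F G n p
  deriv-cong (K L)    G n (clp p) = refl
  deriv-cong (K L)    G n (crp p) = refl
  deriv-cong (K L)    G n (cls p) = refl
  deriv-cong (K L)    G n (crs p) = refl
  deriv-cong (K L)    G n (cac p) = refl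
  deriv-cong (K L)    G n (csg p) = refl
  deriv-cong (F ⊠ H)  G n (clp p) = derivative-cong F G p , Lift≈-refl H _
  deriv-cong (F ⊠ H)  G n (crp p) = Lift≈-refl F _ , derivative-cong H G p
  deriv-cong (F ⊠ H)  G n (cls p) = Lift≈-refl (F ⊠ H) _
  deriv-cong (F ⊠ H)  G n (crs p) = Lift≈-refl (F ⊠ H) _
  deriv-cong (F ⊠ H)  G n (cac p) = Lift≈-refl (F ⊠ H) _
  deriv-cong (F ⊠ H)  G n (csg p) = Lift≈-refl (F ⊠ H) _
  deriv-cong (F ⊞ H)  G n (clp p) = tt
  deriv-cong (F ⊞ H)  G n (crp p) = tt
  deriv-cong (F ⊞ H)  G n (cls p) = derivative-cong F G p
  deriv-cong (F ⊞ H)  G n (crs p) = derivative-cong H G p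
  deriv-cong (F ⊞ H)  G n (cac p) = tt
  deriv-cong (F ⊞ H)  G n (csg p) = tt
  deriv-cong (F ^^ k) G n (clp p) = Lift≈-refl (F ^^ k) _
  deriv-cong (F ^^ k) G n (crp p) = Lift≈-refl (F ^^ k) _
  deriv-cong (F ^^ k) G n (cls p) = Lift≈-refl (F ^^ k) _
  deriv-cong (F ^^ k) G n (crs p) = Lift≈-refl (F ^^ k) _
  deriv-cong (F ^^ k) G n (cac {b = a} p) =
    transportOr-cong (λ j → Fin j → ⟦ F ⟧ Expr) (Lift≈ (F ^^ _)) (Lift≈-refl (F ^^ _) _)
                     (λ a' → ifEq-cong F a a' (derivative-cong F G p))
  deriv-cong (F ^^ k) G n (csg p) = Lift≈-refl (F ^^ k) _
  deriv-cong (𝒫 F)    G n (clp p) = [] , []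
  deriv-cong (𝒫 F)    G n (crp p) = [] , []
  deriv-cong (𝒫 F)    G n (cls p) = [] , []
  deriv-cong (𝒫 F)    G n (crs p) = [] , []
  deriv-cong (𝒫 F)    G n (cac p) = [] , []
  deriv-cong (𝒫 F)    G n (csg p) = Lift≈-singleton F (derivative-cong F G p)

  deriv-cong-μ : ∀ F G n {a a'} → a ≈x a' → Lift≈ F (deriv F G n (μ a)) (deriv F G n (μ a'))
  deriv-cong-μ Id       G n       p = deriv-Id-cong G n (cμ p)
  deriv-cong-μ (K L)    G zero    p = refl
  deriv-cong-μ (F ⊠ H)  G zero    p = Lift≈-refl (F ⊠ H) _
  deriv-cong-μ (F ⊞ H)  G zero    p = tt
  deriv-cong-μ (F ^^ k) G zero    p = Lift≈-refl (F ^^ k) _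
  deriv-cong-μ (𝒫 F)    G zero    p = [] , []
  deriv-cong-μ (K L)    G (suc n) p = deriv-cong (K L) G n (unfold-cong p)
  deriv-cong-μ (F ⊠ H)  G (suc n) p = deriv-cong (F ⊠ H) G n (unfold-cong p)
  deriv-cong-μ (F ⊞ H)  G (suc n) p = deriv-cong (F ⊞ H) G n (unfold-cong p)
  deriv-cong-μ (F ^^ k) G (suc n) p = deriv-cong (F ^^ k) G n (unfold-cong p)
  deriv-cong-μ (𝒫 F)    G (suc n) p = deriv-cong (𝒫 F) G n (unfold-cong p)

  derivative-cong : ∀ F G {a a'} → a ≈x a' → Lift≈ F (derivative F G a) (derivative F G a')
  derivative-cong F G {a} {a'} p =
    subst (λ m → Lift≈ F (deriv F G (μ-depth a) a) (deriv F G m a')) (μ-depth-cong p) (deriv-cong F G _ p)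

⟦_⟧ˢ : Sort → Set
⟦ ⟪ F ⟫ ⟧ˢ = ⟦ F ⟧ Expr
⟦ 𝔹 ⟧ˢ     = Bool

mutual
  ev : (G : Fun) → ∀ {s} → Tm s → ⟦ s ⟧ˢ
  ev G (ex e)       = e
  ev G (δ F t)      = derivative F G (ev G t)
  ev G (emp F)      = Empty F
  ev G (plus F t u) = Plus F (ev G t) (ev G u)
  ev G (cst L b)    = b
  ev G (pair t u)   = ev G t , ev G u
  ev G (k₁ t)       = κ₁ (ev G t)
  ev G (k₂ t)       = κ₂ (ev G t)
  ev G ⊥t           = ⊥ₛ
  ev G ⊤t           = ⊤ₛ
  ev G (fun f)      = λ a → ev G (f a)
  ev G (app f a)    = ev G f a
  ev G (set xs)     = evs G xs
  ev G (t ≃ u)      = does (ev G t ≟ ev G u)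
  ev G tru          = true
  ev G fls          = false

  evs : (G : Fun) → ∀ {F} → List (Tm ⟪ F ⟫) → List (⟦ F ⟧ Expr)
  evs G []       = []
  evs G (x ∷ xs) = ev G x ∷ evs G xs

evs-++ : ∀ G {F} (xs ys : List (Tm ⟪ F ⟫)) → evs G (xs ++ ys) ≡ evs G xs ++ evs G ys
evs-++ G []       ys = refl
evs-++ G (x ∷ xs) ys = cong (ev G x ∷_) (evs-++ G xs ys)

evs-↭ : ∀ G {F} {xs ys : List (Tm ⟪ F ⟫)} → xs ↭ ys → evs G xs ↭ evs G ys
evs-↭ G refl         = refl
evs-↭ G (prep x p)   = prep _ (evs-↭ G p)
evs-↭ G (swap x y p) = swap _ _ (evs-↭ G p)
evs-↭ G (trans p q)  = trans (evs-↭ G p) (evs-↭ G q)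

ev-ifEq : ∀ G {k F} (a a' : Fin k) (t u : Tm ⟪ F ⟫) → ev G (ifEq a a' t u) ≡ ifEq a a' (ev G t) (ev G u)
ev-ifEq G a a' t u with a ≟ a'
... | yes _ = refl
... | no _  = refl

Liftˢ : (Expr → Expr → Set) → (s : Sort) → ⟦ s ⟧ˢ → ⟦ s ⟧ˢ → Set
Liftˢ R ⟪ F ⟫ = Lift F R
Liftˢ R 𝔹     = _≡_

Liftˢ-refl : ∀ {R} → (∀ {e} → R e e) → ∀ s v → Liftˢ R s v v
Liftˢ-refl r ⟪ F ⟫ v = Lift-refl r F v
Liftˢ-refl r 𝔹     v = refl

Liftˢ-sym : ∀ {R} → (∀ {a b} → R a b → R b a) → ∀ s {v w} → Liftˢ R s v w → Liftˢ R s w v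
Liftˢ-sym r ⟪ F ⟫ = Lift-sym r F
Liftˢ-sym r 𝔹     = ≡-sym

Liftˢ-trans : ∀ {R} → (∀ {a b c} → R a b → R b c → R a c) →
              ∀ s {u v w} → Liftˢ R s u v → Liftˢ R s v w → Liftˢ R s u w
Liftˢ-trans r ⟪ F ⟫ = Lift-trans r F
Liftˢ-trans r 𝔹     = ≡-trans

Liftˢ-mono : ∀ {R R'} → (∀ {a b} → R a b → R' a b) → ∀ s {v w} → Liftˢ R s v w → Liftˢ R' s v w
Liftˢ-mono m ⟪ F ⟫ = Lift-mono m F
Liftˢ-mono m 𝔹     p = p

⊢E-sound : ∀ {G s} {t t' : Tm s} → G ⊢E t ≈ t' → Liftˢ _≈x_ s (ev G t) (ev G t')
⊢E-sound {s = s} rfl       = Liftˢ-refl rfl s _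
⊢E-sound {s = s} (sym p)   = Liftˢ-sym sym s (⊢E-sound p)
⊢E-sound {s = s} (trn p q) = Liftˢ-trans trn s (⊢E-sound p) (⊢E-sound q)
⊢E-sound (cex p)           = p
⊢E-sound {G} (cδ {F} p)    = derivative-cong F G (⊢E-sound p)
⊢E-sound (cplus {F} p q)   = Plus-cong F (⊢E-sound p) (⊢E-sound q)
⊢E-sound (cpair p q)       = ⊢E-sound p , ⊢E-sound q
⊢E-sound (ck₁ p)           = ⊢E-sound p
⊢E-sound (ck₂ p)           = ⊢E-sound p
⊢E-sound (cfun q)          = λ a → ⊢E-sound (q a)
⊢E-sound (capp {a = a} p)  = ⊢E-sound p a
⊢E-sound {G} (cset {F} {xs} {ys} p) =
  subst₂ (Lift≈ (𝒫 F)) (≡-sym (evs-++ G xs _)) (≡-sym (evs-++ G xs _))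
    (Plus-cong (𝒫 F) (Lift≈-refl (𝒫 F) (evs G xs))
      (Plus-cong (𝒫 F) {_ ∷ []} (Lift≈-singleton F (⊢E-sound p)) (Lift≈-refl (𝒫 F) (evs G ys))))
⊢E-sound (c≃ p q) = cong₂ (λ x y → does (x ≟ y)) (⊢E-sound p) (⊢E-sound q)
⊢E-sound (δ∅ {F}) = Lift≈-refl F _
⊢E-sound (δ⊕ {F} {e} {e'} (pl c c' , pl w w' , t)) =
  let t₁ , t₂ = Ty-⊕⁻ t in
  Lift≈-reflexive F (cong₂ (Plus F) (deriv-stable (c , w , t₁) (m≤m⊔n (μ-depth e) (μ-depth e')))
                                    (deriv-stable (c' , w' , t₂) (m≤n⊔m (μ-depth e) (μ-depth e'))))
⊢E-sound {G} (δμ {e} (_ , μ g _ , _)) =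
  Lift≈-reflexive G (≡-trans (deriv-μ G (μ-depth e) e) (cong (λ m → deriv G G m (unfold e)) (≡-sym (μ-depth-sub g))))
⊢E-sound (δId {e} G≢Id _) = Lift≈-reflexive Id (deriv-Id G≢Id (μ-depth e) e)
⊢E-sound (δbc {L} {b}) = transportOr-refl Fin (FJSL.bot L) b
⊢E-sound (δlp {F} {H} _) = Lift≈-refl (F ⊠ H) _
⊢E-sound (δrp {F} {H} _) = Lift≈-refl (F ⊠ H) _
⊢E-sound (δls {F} _) = Lift≈-refl F _
⊢E-sound (δrs {H = H} _) = Lift≈-refl H _
⊢E-sound {G} (δac {F} {k} {a} {e} _) a' =
  Lift≈-reflexive F (≡-trans (cong (λ f → f a') (transportOr-refl (λ j → Fin j → ⟦ F ⟧ Expr) _ _))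
                             (≡-sym (ev-ifEq G a a' (δ F (ex e)) (emp F))))
⊢E-sound (δsg {F} _) = Lift≈-refl (𝒫 F) _
⊢E-sound eId = rfl
⊢E-sound eK = refl
⊢E-sound (e⊠ {F} {H}) = Lift≈-refl (F ⊠ H) _
⊢E-sound e⊞ = tt
⊢E-sound (e^ {F}) = λ _ → Lift≈-refl F _
⊢E-sound e𝒫 = [] , []
⊢E-sound pId = rfl
⊢E-sound pK = refl
⊢E-sound (p⊠ {F} {H}) = Lift≈-refl (F ⊠ H) _
⊢E-sound (p11 {F}) = Lift≈-refl F _
⊢E-sound (p22 {H = H}) = Lift≈-refl H _
⊢E-sound p12 = tt
⊢E-sound p21 = tt
⊢E-sound {G} (p⊥l {F} {H} {t}) = Lift≈-refl (F ⊞ H) (ev G t)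
⊢E-sound {G} (p⊥r {F} {H} {t}) = Plus-⊥ʳ F H (ev G t)
⊢E-sound p⊤l = tt
⊢E-sound {G} (p⊤r {F} {H} {t}) = Plus-⊤ʳ F H (ev G t)
⊢E-sound (p^ {F}) = λ _ → Lift≈-refl F _
⊢E-sound {G} (p𝒫 {F} {xs} {ys}) = Lift≈-reflexive (𝒫 F) (≡-sym (evs-++ G xs ys))
⊢E-sound (β {F}) = Lift≈-refl F _
⊢E-sound {G} (sperm {F} p) = Lift≈-↭ F (evs-↭ G p)
⊢E-sound (sdup {F}) = Lift≈-sameElements F (λ { (here x≡v) → here x≡v ; (there x∈) → x∈ }) there
⊢E-sound (≃t {b = b}) = dec-true (b ≟ b) refl
⊢E-sound (≃f {b = b} {b'} b≢b') = dec-false (b ≟ b') b≢b'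

mutual
  Ent-mono : ∀ {G Hs Hs' e} → Hs ⊆ Hs' → Ent G Hs e → Ent G Hs' e
  Ent-mono Hs⊆ (byE p)        = byE p
  Ent-mono Hs⊆ (hyp e∈)       = hyp (Hs⊆ e∈)
  Ent-mono Hs⊆ (sym p)        = sym (Ent-mono Hs⊆ p)
  Ent-mono Hs⊆ (trn p q)      = trn (Ent-mono Hs⊆ p) (Ent-mono Hs⊆ q)
  Ent-mono Hs⊆ (dpair p q)    = dpair (Ent-mono Hs⊆ p) (Ent-mono Hs⊆ q)
  Ent-mono Hs⊆ (dk₁ p)        = dk₁ (Ent-mono Hs⊆ p)
  Ent-mono Hs⊆ (dk₂ p)        = dk₂ (Ent-mono Hs⊆ p)
  Ent-mono Hs⊆ (dfun f)       = dfun (λ a → Ent-mono Hs⊆ (f a))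
  Ent-mono Hs⊆ (dset f g)     = dset (λ i → Ent-mono-∃ Hs⊆ (f i)) (λ j → Ent-mono-∃ Hs⊆ (g j))
  Ent-mono Hs⊆ (interp ip ps) = interp ip (Ent-mono-All Hs⊆ ps)

  Ent-mono-∃ : ∀ {G Hs Hs' A} {P : A → FEq} → Hs ⊆ Hs' → ∃ (Ent G Hs ∘ P) → ∃ (Ent G Hs' ∘ P)
  Ent-mono-∃ Hs⊆ (a , p) = a , Ent-mono Hs⊆ p

  Ent-mono-All : ∀ {G Hs Hs' es} → Hs ⊆ Hs' → All (Ent G Hs) es → All (Ent G Hs') es
  Ent-mono-All Hs⊆ []       = []
  Ent-mono-All Hs⊆ (p ∷ ps) = Ent-mono Hs⊆ p ∷ Ent-mono-All Hs⊆ ps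

≟-true⇒≡ : ∀ {n} {b b' : Fin n} → does (b ≟ b') ≡ true → b ≡ b'
≟-true⇒≡ {b = b} {b'} eq with b ≟ b'
... | yes b≡b' = b≡b'
... | no _ with () ← eq

-- [Derive] only adds Exp-sorted hypotheses, so they can be read as a relation on expressions.
Exp-sorted : FEq → Set
Exp-sorted e = proj₁ e ≡ ⟪ Id ⟫

module Semantics (G : Fun) (Fs : List FEq) (Fs-Exp-sorted : All Exp-sorted Fs) where

  data _≋_ : Expr → Expr → Set where
    ≋-aci   : ∀ {a b} → a ≈x b → a ≋ b
    ≋-hyp   : ∀ {t t'} → (⟪ Id ⟫ , t , t') ∈ Fs → ev G t ≋ ev G t'
    ≋-sym   : ∀ {a b} → a ≋ b → b ≋ a
    ≋-trans : ∀ {a b c} → a ≋ b → b ≋ c → a ≋ c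

  Valid : FEq → Set
  Valid (s , t , t') = Liftˢ _≋_ s (ev G t) (ev G t')

  ⊢E-valid : ∀ {s} {t t' : Tm s} → G ⊢E t ≈ t' → Valid (s , t , t')
  ⊢E-valid {s} p = Liftˢ-mono ≋-aci s (⊢E-sound p)

  valid-modulo-E : ∀ {s} {t t' u u' : Tm s} → G ⊢E t ≈ u → G ⊢E t' ≈ u' →
                   Valid (s , u , u') → Valid (s , t , t')
  valid-modulo-E {s} {t} {t'} {u} {u'} t≈u t'≈u' v =
    Liftˢ-trans ≋-trans s {ev G t} {ev G u} (⊢E-valid t≈u)
      (Liftˢ-trans ≋-trans s {ev G u} {ev G u'} v (Liftˢ-sym ≋-sym s {ev G t'} (⊢E-valid t'≈u')))

  private
    All-evs : ∀ {F} {P : ⟦ F ⟧ Expr → Set} (xs : List (Tm ⟪ F ⟫)) →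
              (∀ i → P (ev G (lookup xs i))) → All P (evs G xs)
    All-evs []       f = []
    All-evs (x ∷ xs) f = f Fin.zero ∷ All-evs xs (f ∘ Fin.suc)

    Any-evs : ∀ {F} {P : ⟦ F ⟧ Expr → Set} (xs : List (Tm ⟪ F ⟫)) →
              ∀ i → P (ev G (lookup xs i)) → Any P (evs G xs)
    Any-evs (x ∷ xs) Fin.zero    p = here p
    Any-evs (x ∷ xs) (Fin.suc i) p = there (Any-evs xs i p)

  valid-set : ∀ {F} (xs ys : List (Tm ⟪ F ⟫)) →
              (∀ i → ∃ λ j → Valid (⟪ F ⟫ , lookup xs i , lookup ys j)) →
              (∀ j → ∃ λ i → Valid (⟪ F ⟫ , lookup xs i , lookup ys j)) →
              Valid (⟪ 𝒫 F ⟫ , set xs , set ys)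
  valid-set xs ys f g =
    All-evs xs (λ i → let j , v = f i in Any-evs ys j v) ,
    All-evs ys (λ j → let i , v = g j in Any-evs xs i v)

  interp-valid : ∀ {e es} → Interp G e es → All Valid es → Valid e
  interp-valid (ipair p q)     (va ∷ vb ∷ []) = valid-modulo-E p q (va , vb)
  interp-valid (ik₁ p q)       (v ∷ [])       = valid-modulo-E p q v
  interp-valid (ik₂ p q)       (v ∷ [])       = valid-modulo-E p q v
  interp-valid (ifun {k = k})  vs             = tabulate⁻ (map⁻ vs)
  interp-valid (iset {F} {xs = xs} {ys} p q c d) vs =
    let vc , vd = ++⁻ (map (λ i → ⟪ F ⟫ , lookup xs i , lookup ys (c i)) (allFin _)) vs
    in valid-modulo-E p q (valid-set xs ys (λ i → c i , tabulate⁻ (map⁻ vc) i)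
                                           (λ j → d j , tabulate⁻ (map⁻ vd) j))
  interp-valid (isl {t = t} {t'}) (v ∷ []) = ≟-true⇒≡ v

  mutual
    Ent-valid : ∀ {e} → Ent G Fs e → Valid e
    Ent-valid (byE p)           = ⊢E-valid p
    Ent-valid (hyp {s , _} e∈) with All.lookup Fs-Exp-sorted e∈
    ... | refl                  = ≋-hyp e∈
    Ent-valid {s , _} (sym p)   = Liftˢ-sym ≋-sym s (Ent-valid p)
    Ent-valid {s , _} (trn p q) = Liftˢ-trans ≋-trans s (Ent-valid p) (Ent-valid q)
    Ent-valid (dpair p q)       = Ent-valid p , Ent-valid q
    Ent-valid (dk₁ p)           = Ent-valid p
    Ent-valid (dk₂ p)           = Ent-valid p
    Ent-valid (dfun f)          = λ a → Ent-valid (f a)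
    Ent-valid (dset {xs = xs} {ys} f g) = valid-set xs ys (Ent-valid-∃ ∘ f) (Ent-valid-∃ ∘ g)
    Ent-valid (interp ip ps)    = interp-valid ip (Ent-valid-All ps)

    Ent-valid-∃ : ∀ {A : Set} {P : A → FEq} → ∃ (Ent G Fs ∘ P) → ∃ (Valid ∘ P)
    Ent-valid-∃ (a , p) = a , Ent-valid p

    Ent-valid-All : ∀ {es} → All (Ent G Fs) es → All Valid es
    Ent-valid-All []       = []
    Ent-valid-All (p ∷ ps) = Ent-valid p ∷ Ent-valid-All ps

Any-zip : ∀ {A : Set} {P Q : A → Set} {xs} → Any P xs → All Q xs → Any (λ x → P x × Q x) xs
Any-zip (here p)  (q ∷ _)  = here (p , q)
Any-zip (there p) (_ ∷ qs) = there (Any-zip p qs)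

Lift-Typed : ∀ {G R} F {v w} → Lift F R v w → Typed G F v → Typed G F w →
             Lift F (λ a b → Exp G a × Exp G b × R a b) v w
Lift-Typed Id                        r       a        b        = a , b , r
Lift-Typed (K L)                     r       _        _        = r
Lift-Typed (F ⊠ H) {_ , _} {_ , _}   (p , q) (a , a') (b , b') = Lift-Typed F p a b , Lift-Typed H q a' b'
Lift-Typed (F ⊞ H) {κ₁ _} {κ₁ _}     r       a        b        = Lift-Typed F r a b
Lift-Typed (F ⊞ H) {κ₂ _} {κ₂ _}     r       a        b        = Lift-Typed H r a b
Lift-Typed (F ⊞ H) {⊥ₛ} {⊥ₛ}         r       _        _        = r
Lift-Typed (F ⊞ H) {⊤ₛ} {⊤ₛ}         r       _        _        = r
Lift-Typed (F ^^ k)                  r       a        b        = λ i → Lift-Typed F (r i) (a i) (b i)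
Lift-Typed (𝒫 F)                     (p , q) as       bs       =
  All.zipWith (λ (l , a) → Any.map (λ (r , b) → Lift-Typed F r a b) (Any-zip l bs)) (p , as) ,
  All.zipWith (λ (l , b) → Any.map (λ (r , a) → Lift-Typed F r a b) (Any-zip l as)) (q , bs)

Exp-sorted-preserved : ∀ {G Fs Gs Fn Gn} → All Exp-sorted Fs →
                       Star (G ⊢_⇒_) (Fs , Gs) (Fn , Gn) → All Exp-sorted Fn
Exp-sorted-preserved sorted ε                = sorted
Exp-sorted-preserved sorted (reduce _ ◅ r)   = Exp-sorted-preserved sorted r
Exp-sorted-preserved sorted (derive _ ◅ r)   = Exp-sorted-preserved (refl ∷ sorted) r
Exp-sorted-preserved sorted (simplify _ ◅ r) = Exp-sorted-preserved sorted r

record Outcome (G : Fun) (Fs Gs Fn : List FEq) : Set where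
  field
    hypotheses-kept : Fs ⊆ Fn
    goals-entailed  : All (Ent G Fn) Gs
    derived-closed  : ∀ {t t'} → (⟪ Id ⟫ , t , t') ∈ Fn →
                      (⟪ Id ⟫ , t , t') ∈ Fs ⊎ Ent G Fn (δ[ G ] (t , t'))

run-outcome : ∀ {G Fs Gs Fn} → Star (G ⊢_⇒_) (Fs , Gs) (Fn , []) → Outcome G Fs Gs Fn
run-outcome ε = record { hypotheses-kept = λ e∈ → e∈ ; goals-entailed = [] ; derived-closed = inj₁ }
run-outcome (reduce {G₁ = G₁} e ◅ r) = record
  { hypotheses-kept = hypotheses-kept
  ; goals-entailed  = let g₁ , g₂ = ++⁻ G₁ goals-entailed in ++⁺ g₁ (Ent-mono hypotheses-kept e ∷ g₂)
  ; derived-closed  = derived-closed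
  } where open Outcome (run-outcome r)
run-outcome {G} {Fs} {Fn = Fn} (derive {G₁ = G₁} {G₂} {t} {t'} _ ◅ r) = record
  { hypotheses-kept = hypotheses-kept ∘ there
  ; goals-entailed  = let g₁ , g₂₃ = ++⁻ G₁ goals-entailed ; g₂ , _ = ++⁻ G₂ g₂₃
                      in ++⁺ g₁ (hyp (hypotheses-kept (here refl)) ∷ g₂)
  ; derived-closed  = new-or-old ∘ derived-closed
  } where
  open Outcome (run-outcome r)
  new-or-old : ∀ {u u'} → (⟪ Id ⟫ , u , u') ∈ (⟪ Id ⟫ , t , t') ∷ Fs ⊎ Ent G Fn (δ[ G ] (u , u')) →
                          (⟪ Id ⟫ , u , u') ∈ Fs ⊎ Ent G Fn (δ[ G ] (u , u'))
  new-or-old (inj₁ (here refl)) = inj₂ (All.head (++⁻ʳ G₂ (++⁻ʳ G₁ goals-entailed)))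
  new-or-old (inj₁ (there u∈))  = inj₁ u∈
  new-or-old (inj₂ δu)          = inj₂ δu
run-outcome (simplify {G₁ = G₁} {es = es} ip ◅ r) = record
  { hypotheses-kept = hypotheses-kept
  ; goals-entailed  = let g₁ , g₂₃ = ++⁻ G₁ goals-entailed ; g₂ , g₃ = ++⁻ es g₂₃
                      in ++⁺ g₁ (interp ip g₂ ∷ g₃)
  ; derived-closed  = derived-closed
  } where open Outcome (run-outcome r)

module _ (G : Fun) (Fs : List FEq) (Fs-Exp-sorted : All Exp-sorted Fs)
         (derivatives-entailed : ∀ {t t'} → (⟪ Id ⟫ , t , t') ∈ Fs → Ent G Fs (δ[ G ] (t , t')))
         where
  open Semantics G Fs Fs-Exp-sorted

  ≋-derivative : ∀ {a b} → a ≋ b → Lift G _≋_ (derivative G G a) (derivative G G b)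
  ≋-derivative (≋-aci p)     = Lift-mono ≋-aci G (derivative-cong G G p)
  ≋-derivative (≋-hyp t∈)    = Ent-valid (derivatives-entailed t∈)
  ≋-derivative (≋-sym p)     = Lift-sym ≋-sym G (≋-derivative p)
  ≋-derivative (≋-trans p q) = Lift-trans ≋-trans G (≋-derivative p) (≋-derivative q)

  Exp-≋ : Expr → Expr → Set
  Exp-≋ a b = Exp G a × Exp G b × a ≋ b

  Exp-≋-isBisim : IsBisim G Exp-≋
  Exp-≋-isBisim e e' (x@(_ , w , _) , x'@(_ , w' , _) , e≋e') = x , x' , λ v v' d d' →
    Lift-Typed G (subst₂ (Lift G _≋_) (Δ⇒deriv d w ≤-refl) (Δ⇒deriv d' w' ≤-refl) (≋-derivative e≋e'))
                 (Δ-Typed x d) (Δ-Typed x' d')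

theorem3 : (G : Fun) (𝒢 : List (Expr × Expr)) →
           All (λ p → Exp G (proj₁ p) × Exp G (proj₂ p)) 𝒢 →
           (Fn : List FEq) →
           Star (G ⊢_⇒_) ([] , map ⌈_⌉ 𝒢) (Fn , []) →
           All (λ p → proj₁ p ∼[ G ] proj₂ p) 𝒢
theorem3 G 𝒢 typed Fn run =
  All.zipWith (λ ((x , x') , goal) → Exp-≋ G Fn sorted closed , Exp-≋-isBisim G Fn sorted closed ,
                                     x , x' , Semantics.Ent-valid G Fn sorted goal)
              (typed , map⁻ goals-entailed)
  where
  open Outcome (run-outcome run)
  sorted : All Exp-sorted Fn
  sorted = Exp-sorted-preserved [] run
  closed : ∀ {t t'} → (⟪ Id ⟫ , t , t') ∈ Fn → Ent G Fn (δ[ G ] (t , t'))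
  closed t∈ with derived-closed t∈
  ... | inj₂ δt = δt
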